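{- Assume that $k=2^{\beta}M$, with $\beta > 0$ and $M$ is an odd positive integer. Then $\phi(n)/|\mathcal{U}_k(n)|=1$ if and only if $n$ is a divisor of $$2^{\beta+2}\prod_{p \in \mathcal{A}} p \prod_{ q\in \mathcal{B}} q^{\nu_{q}(M)+1},$$ where $$\mathcal{A}:=\left\{p: p \text{ is prime, } p\nmid M \text{ and } p=2^{l}d+1, \text{ with } 0<l\leq \beta \text{ and } d|M\right\},$$ and $$\mathcal{B}:=\left\{q: q \text{ is prime, } q|M \text{ and } q=2^ld+1, \text{ with } 0<l\leq \beta \text{ and } d|M\right\}.$$
   Context: For a positive integer $k$ and a positive integer $n$, $\mathcal{U}_k(n)=\{a\in\mathcal{U}(\mathbb{Z}_n): a^k=1\}$ denotes the set of $k$-units modulo $n$, where $\mathcal{U}(\mathbb{Z}_n)$ is the unit group of $\mathbb{Z}_n$. $\phi$ is Euler's totient function and $\nu_q(M)$ is the exponent of the largest power of the prime $q$ dividing $M$. Thus $\phi(n)/|\mathcal{U}_k(n)|=1$ means every unit $u$ modulo $n$ satisfies $u^k=1$. -}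

module Defs where

open import Data.Nat using (ℕ; zero; suc; _+_; _*_; _^_; _<_; _≤_; NonZero; _⊔_)
open import Data.Nat.DivMod using (_%_)
open import Data.Nat.Divisibility using (_∣_; _∣?_)
open import Data.Nat.Coprimality using (Coprime; coprime?)
open import Data.Nat.Primality using (Prime; prime?)
open import Data.Nat.Properties using (_≟_)
open import Data.Bool using (Bool; true; false; if_then_else_; _∧_)
open import Data.List using (List; upTo; filter; length; map; foldr)
open import Data.Bool.ListAction using (any)
open import Data.Nat.ListAction using (product)
open import Data.Product using (_×_)
open import Relation.Nullary.Decidable using (⌊_⌋; _×-dec_)
open import Relation.Binary.PropositionalEquality using (_≡_)

units : (n : ℕ) → List ℕ
units n = filter (λ a → coprime? a n) (upTo n)

φ : ℕ → ℕ
φ n = length (units n)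

kUnits : (k n : ℕ) → .{{NonZero n}} → List ℕ
kUnits k n = filter (λ a → (a ^ k) % n ≟ 1 % n) (units n)

-- ν_q(M): exponent of the largest power of q dividing M
-- (for M ≥ 1 and q ≥ 2 this exponent is ≤ M, so searching e ∈ {0,…,M} suffices).
ν : (q M : ℕ) → ℕ
ν q M = foldr _⊔_ 0 (map (λ e → if ⌊ (q ^ e) ∣? M ⌋ then e else 0) (upTo (suc M)))

-- p = 2^l d + 1 for some 0 < l ≤ β and d ∣ M
-- (d ∣ M with M ≥ 1 forces 1 ≤ d ≤ M, so the search is over these ranges).
specialForm : (β M p : ℕ) → Bool
specialForm β M p =
  any (λ l → any (λ d → ⌊ d ∣? M ⌋ ∧ ⌊ p ≟ 2 ^ suc l * d + 1 ⌋) (upTo (suc M))) (upTo β)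

factor : (β M p : ℕ) → ℕ
factor β M p =
  if ⌊ prime? p ⌋ ∧ specialForm β M p
  then (if ⌊ p ∣? M ⌋ then p ^ (ν p M + 1) else p)
  else 1

-- 2^(β+2) ∏_{p∈𝒜} p ∏_{q∈ℬ} q^(ν_q(M)+1); all elements of 𝒜 ∪ ℬ are ≤ 2^β M + 1.
bound : (β M : ℕ) → ℕ
bound β M = 2 ^ (β + 2) * product (map (factor β M) (upTo (2 ^ β * M + 2)))

-- φ(n) = |U_k(n)| says that k annihilates the unit group of ℤ/n. Both this and n ∣ bound
-- are multiplicative in n, so it suffices to compare them on prime powers. Modulo 2ᵉ the
-- condition holds iff e ≤ β + 2: every odd u has u^(2ⁱ⁺¹) ≡ 1 modulo 2ⁱ⁺³, while 5 has
-- order exactly 2ⁱ⁺¹ there. Modulo pⁱ⁺¹ with p odd, Fermat and Hensel lifting give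
-- u^((p-1)pⁱ) ≡ 1; conversely (p - 1) ∣ k follows from Lagrange's bound on the roots of
-- x^g - 1 modulo p, and pⁱ ∣ k from 1 + p having order exactly pⁱ. Finally, for an odd
-- prime p, (p - 1) ∣ 2^β M is exactly the condition p = 2ˡ d + 1 defining 𝒜 ∪ ℬ.

module Submission where

module Arithmetic where

  open import Data.Nat.Base
  open import Data.Nat.Properties
  open import Data.Nat.Divisibility
  open import Data.Nat.Coprimality using (Coprime; coprime-divisor; coprime⇒gcd≡1; 1-coprimeTo)
  import Data.Nat.Coprimality as Coprime
  open import Data.Nat.LCM using (lcm; lcm-least; gcd*lcm)
  open import Data.Nat.Primality using (Prime; prime⇒nonTrivial; prime⇒irreducible)
  open import Data.Nat.Induction using (<-rec)
  open import Data.Nat.Solver using (module +-*-Solver)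
  open import Data.Product.Base using (∃-syntax; ∃₂; _×_; _,_)
  open import Data.Sum.Base using (inj₁; inj₂)
  open import Relation.Binary.PropositionalEquality
  open import Relation.Nullary.Decidable using (yes; no)
  open import Relation.Nullary.Negation using (¬_; contradiction)
  open +-*-Solver using (solve; _:+_; _:*_; _:=_; con)

  prime>1 : ∀ {p} → Prime p → 1 < p
  prime>1 {p} pr = nonTrivial⇒n>1 p {{prime⇒nonTrivial pr}}

  ^-monoʳ-∣ : ∀ p {a b} → a ≤ b → p ^ a ∣ p ^ b
  ^-monoʳ-∣ p {a} {b} a≤b = divides (p ^ (b ∸ a)) (begin
    p ^ b               ≡⟨ cong (p ^_) (m+[n∸m]≡n a≤b) ⟨
    p ^ (a + (b ∸ a))   ≡⟨ ^-distribˡ-+-* p a (b ∸ a) ⟩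
    p ^ a * p ^ (b ∸ a) ≡⟨ *-comm (p ^ a) _ ⟩
    p ^ (b ∸ a) * p ^ a ∎)
    where open ≡-Reasoning

  ^-∣^⇒≤ : ∀ p → 1 < p → ∀ {a b} → p ^ a ∣ p ^ b → a ≤ b
  ^-∣^⇒≤ p@(suc _) 1<p {a} {b} pᵃ∣pᵇ with a ≤? b
  ... | yes a≤b = a≤b
  ... | no  a≰b = contradiction (∣⇒≤ {{m^n≢0 p b}} pᵃ∣pᵇ) (<⇒≱ (^-monoʳ-< p 1<p (≰⇒> a≰b)))

  split-power : ∀ p → 1 < p → ∀ N .{{_ : NonZero N}} → ∃₂ λ a r → N ≡ p ^ a * r × ¬ p ∣ r
  split-power p 1<p = <-rec P split
    where
      P : ℕ → Set
      P N = .{{NonZero N}} → ∃₂ λ a r → N ≡ p ^ a * r × ¬ p ∣ r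
      split : ∀ N → (∀ {M} → M < N → P M) → P N
      split N@(suc _) rec with p ∣? N
      ... | no  p∤N = 0 , N , sym (+-identityʳ N) , p∤N
      ... | yes (divides zero ())
      ... | yes (divides q@(suc _) N≡qp) with rec (subst (q <_) (sym N≡qp) (m<m*n q p 1<p))
      ...   | a , r , q≡pᵃr , p∤r =
        suc a , r , trans N≡qp (trans (cong (_* p) q≡pᵃr) (ring (p ^ a) r p)) , p∤r
        where ring : ∀ x r p → x * r * p ≡ p * x * r
              ring = solve 3 (λ x r p → x :* r :* p := p :* x :* r) refl

  odd⇒≡1+2* : ∀ u → ¬ 2 ∣ u → ∃[ t ] u ≡ 1 + 2 * t
  odd⇒≡1+2* zero          2∤u = contradiction (2 ∣0) 2∤u
  odd⇒≡1+2* (suc zero)    2∤u = 0 , refl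
  odd⇒≡1+2* (suc (suc u)) 2∤u with odd⇒≡1+2* u (λ 2∣u → 2∤u (∣m∣n⇒∣m+n ∣-refl 2∣u))
  ... | t , refl = suc t , ring t
    where ring : ∀ t → 3 + 2 * t ≡ 1 + 2 * (1 + t)
          ring = solve 1 (λ t → con 3 :+ con 2 :* t := con 1 :+ con 2 :* (con 1 :+ t)) refl

  triangular : ℕ → ℕ
  triangular zero    = 0
  triangular (suc r) = triangular r + r

  2*triangular : ∀ n → 2 * triangular (suc n) ≡ suc n * n
  2*triangular zero    = refl
  2*triangular (suc n) = begin
    2 * (triangular (suc n) + suc n)     ≡⟨ *-distribˡ-+ 2 (triangular (suc n)) (suc n) ⟩
    2 * triangular (suc n) + 2 * suc n   ≡⟨ cong (_+ 2 * suc n) (2*triangular n) ⟩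
    suc n * n + 2 * suc n                ≡⟨ ring n ⟩
    suc (suc n) * suc n                  ∎
    where open ≡-Reasoning
          ring : ∀ n → (1 + n) * n + 2 * (1 + n) ≡ (2 + n) * (1 + n)
          ring = solve 1 (λ n → (con 1 :+ n) :* n :+ con 2 :* (con 1 :+ n) := (con 2 :+ n) :* (con 1 :+ n)) refl

  triangular-odd : ∀ h → triangular (1 + 2 * h) ≡ (1 + 2 * h) * h
  triangular-odd h = *-cancelˡ-≡ _ _ 2 (begin
    2 * triangular (1 + 2 * h) ≡⟨ 2*triangular (2 * h) ⟩
    (1 + 2 * h) * (2 * h)      ≡⟨ ring h ⟩
    2 * ((1 + 2 * h) * h)      ∎)
    where open ≡-Reasoning
          ring : ∀ h → (1 + 2 * h) * (2 * h) ≡ 2 * ((1 + 2 * h) * h)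
          ring = solve 1 (λ h → (con 1 :+ con 2 :* h) :* (con 2 :* h) := con 2 :* ((con 1 :+ con 2 :* h) :* h)) refl

  coprime-∣ : ∀ {a m n} → Coprime a n → m ∣ n → Coprime a m
  coprime-∣ a⊥n m∣n (d∣a , d∣m) = a⊥n (d∣a , ∣-trans d∣m m∣n)

  coprime-* : ∀ {a m n} → Coprime a m → Coprime a n → Coprime a (m * n)
  coprime-* {a} {m} {n} a⊥m a⊥n {d} (d∣a , d∣mn) = a⊥n (d∣a , coprime-divisor d⊥m d∣mn)
    where d⊥m : Coprime d m
          d⊥m (c∣d , c∣m) = a⊥m (∣-trans c∣d d∣a , c∣m)

  coprime-^ : ∀ {a m} → Coprime a m → ∀ e → Coprime a (m ^ e)
  coprime-^ {a} a⊥m zero    = Coprime.sym (1-coprimeTo a)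
  coprime-^     a⊥m (suc e) = coprime-* a⊥m (coprime-^ a⊥m e)

  ^-coprime : ∀ {a m} e → Coprime a m → Coprime (a ^ e) m
  ^-coprime e a⊥m = Coprime.sym (coprime-^ (Coprime.sym a⊥m) e)

  prime∤⇒coprime : ∀ {p a} → Prime p → ¬ p ∣ a → Coprime p a
  prime∤⇒coprime pr p∤a (d∣p , d∣a) with prime⇒irreducible pr d∣p
  ... | inj₁ d≡1 = d≡1
  ... | inj₂ refl = contradiction d∣a p∤a

  coprime⇒*∣ : ∀ {m n c} → Coprime m n → m ∣ c → n ∣ c → m * n ∣ c
  coprime⇒*∣ {m} {n} m⊥n m∣c n∣c = subst (_∣ _) lcm≡mn (lcm-least m∣c n∣c)
    where lcm≡mn : lcm m n ≡ m * n
          lcm≡mn = trans (sym (+-identityʳ (lcm m n))) (trans (cong (_* lcm m n) (sym (coprime⇒gcd≡1 m⊥n))) (gcd*lcm m n))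

  coprime-+* : ∀ {m n} c → Coprime m n → Coprime (m + c * n) n
  coprime-+* {m} {n} c m⊥n {d} (d∣m+cn , d∣n) = m⊥n (∣m+n∣m⇒∣n (subst (d ∣_) (+-comm m (c * n)) d∣m+cn) (∣n⇒∣m*n c d∣n) , d∣n)

  prime∤⇒coprime-^ : ∀ {p a} → Prime p → ¬ p ∣ a → ∀ e → Coprime a (p ^ e)
  prime∤⇒coprime-^ pr p∤a = coprime-^ (Coprime.sym (prime∤⇒coprime pr p∤a))

  coprime-^suc⇒∤ : ∀ {p a} → Prime p → ∀ i → Coprime a (p ^ suc i) → ¬ p ∣ a
  coprime-^suc⇒∤ {p} pr i a⊥pⁱ⁺¹ p∣a = <⇒≢ (prime>1 pr) (sym (a⊥pⁱ⁺¹ (p∣a , m∣m*n (p ^ i))))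

  ¬2∣⇒nonZero : ∀ {m} → ¬ 2 ∣ m → NonZero m
  ¬2∣⇒nonZero {zero}  2∤0 = contradiction (2 ∣0) 2∤0
  ¬2∣⇒nonZero {suc m} _   = _

module Congruence where

  open import Data.Nat.Base as ℕ using (ℕ; zero; suc; NonZero)
  import Data.Nat.Properties as ℕ
  open import Data.Nat.Divisibility using (_∣_; divides; quotient; m∣n⇒n≡quotient*m)
  open import Data.Nat.DivMod using (_%_; _/_; m≡m%n+[m/n]*n; [m+kn]%n≡m%n)
  open import Data.Nat.Coprimality using (Coprime; coprime-divisor)
  open import Data.Nat.Primality using (Prime; euclidsLemma)
  open import Data.Integer.Base using (ℤ; +_; -[1+_]; _+_; _*_; _-_; -_; _^_; ∣_∣; 0ℤ; 1ℤ)
  open import Data.Integer.Properties using (pos-+; pos-*; abs-*; +-injective; *-assoc)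
  open import Data.Integer.Divisibility.Signed as Signed using (∣ᵤ⇒∣)
  open import Data.Integer.Tactic.RingSolver using (solve-∀; solve)
  open import Data.List.Base using (_∷_; [])
  open import Data.Product.Base using (_,_; ∃-syntax)
  open import Data.Sum.Base using (_⊎_; inj₁; inj₂; [_,_]′)
  open import Function.Base using (flip)
  open import Level using (0ℓ)
  open import Relation.Binary.Bundles using (Setoid)
  import Relation.Binary.Reasoning.Setoid as SetoidReasoning
  open import Relation.Binary.PropositionalEquality
  open import Relation.Nullary.Negation using (¬_; contradiction)

  infix 4 _≡_[mod_]
  record _≡_[mod_] (a b : ℤ) (n : ℕ) : Set where
    constructor congruent
    field
      multiple : ℤ
      equation : a ≡ b + multiple * + n

  mod-refl : ∀ {n} a → a ≡ a [mod n ]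
  mod-refl {n} a = congruent 0ℤ (ring a (+ n))
    where ring : ∀ a x → a ≡ a + 0ℤ * x
          ring = solve-∀

  mod-reflexive : ∀ {n a b} → a ≡ b → a ≡ b [mod n ]
  mod-reflexive {b = b} refl = mod-refl b

  mod-sym : ∀ {n a b} → a ≡ b [mod n ] → b ≡ a [mod n ]
  mod-sym {n} {b = b} (congruent t refl) = congruent (- t) (ring b t (+ n))
    where ring : ∀ b t x → b ≡ b + t * x + (- t) * x
          ring = solve-∀

  mod-trans : ∀ {n a b c} → a ≡ b [mod n ] → b ≡ c [mod n ] → a ≡ c [mod n ]
  mod-trans {n} {c = c} (congruent t refl) (congruent s refl) = congruent (s + t) (ring c s t (+ n))
    where ring : ∀ c s t x → c + s * x + t * x ≡ c + (s + t) * x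
          ring = solve-∀

  mod-+ : ∀ {n a b c d} → a ≡ b [mod n ] → c ≡ d [mod n ] → a + c ≡ b + d [mod n ]
  mod-+ {n} {b = b} {d = d} (congruent t refl) (congruent s refl) = congruent (t + s) (ring b d s t (+ n))
    where ring : ∀ b d s t x → b + t * x + (d + s * x) ≡ b + d + (t + s) * x
          ring = solve-∀

  mod-* : ∀ {n a b c d} → a ≡ b [mod n ] → c ≡ d [mod n ] → a * c ≡ b * d [mod n ]
  mod-* {n} {b = b} {d = d} (congruent t refl) (congruent s refl) =
    congruent (t * d + b * s + t * s * + n) (ring b d s t (+ n))
    where ring : ∀ b d s t x → (b + t * x) * (d + s * x) ≡ b * d + (t * d + b * s + t * s * x) * x
          ring = solve-∀

  mod-setoid : ℕ → Setoid 0ℓ 0ℓ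
  mod-setoid n = record
    { Carrier       = ℤ
    ; _≈_           = λ a b → a ≡ b [mod n ]
    ; isEquivalence = record { refl = mod-refl _ ; sym = mod-sym ; trans = mod-trans }
    }

  module ≡-mod-Reasoning (n : ℕ) = SetoidReasoning (mod-setoid n)

  mod-^ : ∀ {n a b} k → a ≡ b [mod n ] → a ^ k ≡ b ^ k [mod n ]
  mod-^ zero    a≡b = mod-refl 1ℤ
  mod-^ (suc k) a≡b = mod-* a≡b (mod-^ k a≡b)

  mod-divisor : ∀ {m n a b} → m ∣ n → a ≡ b [mod n ] → a ≡ b [mod m ]
  mod-divisor {m} {b = b} (divides q refl) (congruent t refl) =
    congruent (t * + q) (cong (λ x → b + x) (trans (cong (t *_) (pos-* q m)) (sym (*-assoc t (+ q) (+ m)))))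

  mod-1 : ∀ a b → a ≡ b [mod 1 ]
  mod-1 a b = congruent (a - b) (ring a b)
    where ring : ∀ a b → a ≡ b + (a - b) * 1ℤ
          ring = solve-∀

  mod⇒∣ : ∀ {n a b} → a ≡ b [mod n ] → n ∣ ∣ a - b ∣
  mod⇒∣ {n} {b = b} (congruent t refl) = divides ∣ t ∣ (trans (cong ∣_∣ (ring b t (+ n))) (abs-* t (+ n)))
    where ring : ∀ b t x → b + t * x - b ≡ t * x
          ring = solve-∀

  ∣⇒mod : ∀ {n a b} → n ∣ ∣ a - b ∣ → a ≡ b [mod n ]
  ∣⇒mod {n} {a} {b} n∣a-b with ∣ᵤ⇒∣ {+ n} {a - b} n∣a-b
  ... | Signed.divides t a-b≡tn = congruent t (trans (ring a b) (cong (λ x → b + x) a-b≡tn))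
    where ring : ∀ a b → a ≡ b + (a - b)
          ring = solve-∀

  mod0⇒∣ : ∀ {n a} → a ≡ 0ℤ [mod n ] → n ∣ ∣ a ∣
  mod0⇒∣ {n} {a} a≡0 = subst (λ z → n ∣ ∣ z ∣) (ring a) (mod⇒∣ a≡0)
    where ring : ∀ a → a - 0ℤ ≡ a
          ring = solve-∀

  ∣⇒mod0 : ∀ {n a} → n ∣ ∣ a ∣ → a ≡ 0ℤ [mod n ]
  ∣⇒mod0 {n} {a} n∣a = ∣⇒mod (subst (λ z → n ∣ ∣ z ∣) (ring a) n∣a)
    where ring : ∀ a → a ≡ a - 0ℤ
          ring = solve-∀

  mod-difference : ∀ {n a b} → a ≡ b [mod n ] → a - b ≡ 0ℤ [mod n ]
  mod-difference {b = b} a≡b = mod-trans (mod-+ a≡b (mod-refl (- b))) (mod-reflexive (ring b))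
    where ring : ∀ b → b - b ≡ 0ℤ
          ring = solve-∀

  difference-mod : ∀ {n a b} → a - b ≡ 0ℤ [mod n ] → a ≡ b [mod n ]
  difference-mod {a = a} {b} a-b≡0 =
    mod-trans (mod-reflexive (ring a b)) (mod-trans (mod-+ a-b≡0 (mod-refl b)) (mod-reflexive (ring′ b)))
    where ring : ∀ a b → a ≡ a - b + b
          ring = solve-∀
          ring′ : ∀ b → 0ℤ + b ≡ b
          ring′ = solve-∀

  mod-euclid : ∀ {p a b} → Prime p → a * b ≡ 0ℤ [mod p ] → a ≡ 0ℤ [mod p ] ⊎ b ≡ 0ℤ [mod p ]
  mod-euclid {p} {a} {b} pr ab≡0 with euclidsLemma ∣ a ∣ ∣ b ∣ pr (subst (p ∣_) (abs-* a b) (mod0⇒∣ ab≡0))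
  ... | inj₁ p∣a = inj₁ (∣⇒mod0 p∣a)
  ... | inj₂ p∣b = inj₂ (∣⇒mod0 p∣b)

  mod-cancel : ∀ {p a b c} → Prime p → ¬ (a ≡ 0ℤ [mod p ]) → a * b ≡ a * c [mod p ] → b ≡ c [mod p ]
  mod-cancel {p} {a} {b} {c} pr a≢0 ab≡ac =
    [ flip contradiction a≢0 , difference-mod ]′ (mod-euclid pr (mod-trans (mod-reflexive (ring a b c)) (mod-difference ab≡ac)))
    where ring : ∀ a b c → a * (b - c) ≡ a * b - a * c
          ring = solve-∀

  mod-crt : ∀ {m n a b} → Coprime m n → a ≡ b [mod m ] → a ≡ b [mod n ] → a ≡ b [mod m ℕ.* n ]
  mod-crt {m} {n} m⊥n a≡b[m] a≡b[n] with mod⇒∣ a≡b[m] | mod⇒∣ a≡b[n]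
  ... | m∣d | divides q d≡qn =
    ∣⇒mod (divides (quotient m∣q) (trans d≡qn (trans (cong (ℕ._* n) (m∣n⇒n≡quotient*m m∣q)) (ℕ.*-assoc (quotient m∣q) m n))))
    where m∣q : m ∣ q
          m∣q = coprime-divisor m⊥n (subst (m ∣_) (trans d≡qn (ℕ.*-comm q n)) m∣d)

  pos-+-multiple : ∀ a s n → + (a ℕ.+ s ℕ.* n) ≡ + a + + s * + n
  pos-+-multiple a s n = trans (pos-+ a _) (cong (λ x → + a + x) (pos-* s n))

  pos-*-* : ∀ a b c → + (a ℕ.* b ℕ.* c) ≡ + a * + b * + c
  pos-*-* a b c = trans (pos-* (a ℕ.* b) c) (cong (_* + c) (pos-* a b))

  %≡%⇒mod : ∀ a b n .{{_ : NonZero n}} → a % n ≡ b % n → + a ≡ + b [mod n ]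
  %≡%⇒mod a b n a%n≡b%n = congruent (+ (a / n) - + (b / n)) (begin
    + a                                              ≡⟨ cong +_ (m≡m%n+[m/n]*n a n) ⟩
    + (a % n ℕ.+ a / n ℕ.* n)                        ≡⟨ pos-+-multiple (a % n) (a / n) n ⟩
    + (a % n) + + (a / n) * + n                      ≡⟨ cong (λ r → + r + + (a / n) * + n) a%n≡b%n ⟩
    + (b % n) + + (a / n) * + n                      ≡⟨ ring (+ (b % n)) (+ (a / n)) (+ (b / n)) (+ n) ⟩
    + (b % n) + + (b / n) * + n + (+ (a / n) - + (b / n)) * + n
      ≡⟨ cong (_+ (+ (a / n) - + (b / n)) * + n) (sym (trans (cong +_ (m≡m%n+[m/n]*n b n)) (pos-+-multiple (b % n) (b / n) n))) ⟩
    + b + (+ (a / n) - + (b / n)) * + n              ∎)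
    where
      open ≡-Reasoning
      ring : ∀ r x y n → r + x * n ≡ (r + y * n) + (x - y) * n
      ring = solve-∀

  mod⇒≡+multiple : ∀ {n a b} → + a ≡ + b [mod n ] →
                   (∃[ s ] a ≡ b ℕ.+ s ℕ.* n) ⊎ (∃[ s ] b ≡ a ℕ.+ s ℕ.* n)
  mod⇒≡+multiple {n} {a} {b} (congruent (+ s) eq) =
    inj₁ (s , +-injective (trans eq (sym (pos-+-multiple b s n))))
  mod⇒≡+multiple {n} {a} {b} (congruent -[1+ s ] eq) =
    inj₂ (suc s , +-injective (trans (ring (+ a) (+ b) -[1+ s ] (+ n) eq) (sym (pos-+-multiple a (suc s) n))))
    where ring : ∀ a b t n → a ≡ b + t * n → b ≡ a + (- t) * n
          ring a b t n refl = solve (b ∷ t ∷ n ∷ [])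

  mod⇒%≡% : ∀ a b n .{{_ : NonZero n}} → + a ≡ + b [mod n ] → a % n ≡ b % n
  mod⇒%≡% a b n a≡b with mod⇒≡+multiple a≡b
  ... | inj₁ (s , refl) = [m+kn]%n≡m%n b s n
  ... | inj₂ (s , refl) = sym ([m+kn]%n≡m%n a s n)

  ^-distribʳ-* : ∀ a b k → (a * b) ^ k ≡ a ^ k * b ^ k
  ^-distribʳ-* a b zero    = refl
  ^-distribʳ-* a b (suc k) = trans (cong (a * b *_) (^-distribʳ-* a b k)) (ring a b (a ^ k) (b ^ k))
    where ring : ∀ a b x y → a * b * (x * y) ≡ a * x * (b * y)
          ring = solve-∀

  pos-^ : ∀ a k → + (a ℕ.^ k) ≡ (+ a) ^ k
  pos-^ a zero    = refl
  pos-^ a (suc k) = trans (pos-* a (a ℕ.^ k)) (cong (+ a *_) (pos-^ a k))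

module Fermat where

  open import Data.Nat.Base
  open import Data.Nat.Properties
  open import Data.Nat.Divisibility using (_∣_; divides; _∣0; ∣m∣n⇒∣m+n; ∣n⇒∣m*n)
  open import Data.Nat.Combinatorics using (_C_; nCn≡1; nC1≡n; k>n⇒nCk≡0; nCk+nC[k+1]≡[n+1]C[k+1])
  open import Data.Nat.Coprimality using (prime⇒coprime; coprime-divisor)
  open import Data.Nat.Primality using (Prime)
  open import Data.Nat.Solver using (module +-*-Solver)
  open import Data.Product.Base using (∃-syntax; _,_)
  open import Function.Base using (_∘_)
  open import Relation.Binary.PropositionalEquality
  open +-*-Solver using (solve; _:+_; _:*_; _:=_; con)
  open ≡-Reasoning

  horner : (ℕ → ℕ) → ℕ → ℕ → ℕ
  horner f zero    x = 0
  horner f (suc m) x = f 0 + x * horner (f ∘ suc) m x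

  horner-+ : ∀ f g m x → horner (λ i → f i + g i) m x ≡ horner f m x + horner g m x
  horner-+ f g zero    x = refl
  horner-+ f g (suc m) x = begin
    f 0 + g 0 + x * horner (λ i → f (suc i) + g (suc i)) m x
      ≡⟨ cong (λ h → f 0 + g 0 + x * h) (horner-+ (f ∘ suc) (g ∘ suc) m x) ⟩
    f 0 + g 0 + x * (horner (f ∘ suc) m x + horner (g ∘ suc) m x)
      ≡⟨ ring (f 0) (g 0) x (horner (f ∘ suc) m x) (horner (g ∘ suc) m x) ⟩
    horner f (suc m) x + horner g (suc m) x ∎
    where ring : ∀ a b x u v → a + b + x * (u + v) ≡ a + x * u + (b + x * v)
          ring = solve 5 (λ a b x u v → a :+ b :+ x :* (u :+ v) := a :+ x :* u :+ (b :+ x :* v)) refl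

  horner-∷ʳ : ∀ f m x → horner f (suc m) x ≡ horner f m x + f m * x ^ m
  horner-∷ʳ f zero    x = ring (f 0) x
    where ring : ∀ a x → a + x * 0 ≡ 0 + a * 1
          ring = solve 2 (λ a x → a :+ x :* con 0 := con 0 :+ a :* con 1) refl
  horner-∷ʳ f (suc m) x = begin
    f 0 + x * horner (f ∘ suc) (suc m) x ≡⟨ cong (λ h → f 0 + x * h) (horner-∷ʳ (f ∘ suc) m x) ⟩
    f 0 + x * (horner (f ∘ suc) m x + f (suc m) * x ^ m)
      ≡⟨ ring (f 0) x (horner (f ∘ suc) m x) (f (suc m)) (x ^ m) ⟩
    horner f (suc m) x + f (suc m) * x ^ suc m ∎
    where ring : ∀ a x u b y → a + x * (u + b * y) ≡ a + x * u + b * (x * y)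
          ring = solve 5 (λ a x u b y → a :+ x :* (u :+ b :* y) := a :+ x :* u :+ b :* (x :* y)) refl

  horner-cong : ∀ {f g} m x → (∀ i → f i ≡ g i) → horner f m x ≡ horner g m x
  horner-cong zero    x f≗g = refl
  horner-cong (suc m) x f≗g = cong₂ (λ a h → a + x * h) (f≗g 0) (horner-cong m x (f≗g ∘ suc))

  horner-∣ : ∀ {d} f m x → (∀ i → i < m → d ∣ f i) → d ∣ horner f m x
  horner-∣ f zero    x d∣f = _ ∣0
  horner-∣ f (suc m) x d∣f =
    ∣m∣n⇒∣m+n (d∣f 0 z<s) (∣n⇒∣m*n x (horner-∣ (f ∘ suc) m x (λ i i<m → d∣f (suc i) (s<s i<m))))

  binomial : ∀ n x → (1 + x) ^ n ≡ horner (n C_) (suc n) x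
  binomial zero    x = ring x
    where ring : ∀ x → 1 ≡ 1 + x * 0
          ring = solve 1 (λ x → con 1 := con 1 :+ x :* con 0) refl
  binomial (suc n) x = begin
    (1 + x) * (1 + x) ^ n                    ≡⟨ cong ((1 + x) *_) (binomial n x) ⟩
    (1 + x) * (1 + x * E)                    ≡⟨ ring x E (x ^ n) ⟩
    1 + x * ((1 + x * E) + (E + 0 * x ^ n))  ≡⟨ cong (λ c → 1 + x * ((1 + x * E) + (E + c * x ^ n))) (sym (k>n⇒nCk≡0 (n<1+n n))) ⟩
    1 + x * (horner (n C_) (suc n) x + (E + (n C suc n) * x ^ n))
      ≡⟨ cong (λ h → 1 + x * (horner (n C_) (suc n) x + h)) (sym (horner-∷ʳ (λ i → n C suc i) n x)) ⟩
    1 + x * (horner (n C_) (suc n) x + horner (λ i → n C suc i) (suc n) x)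
      ≡⟨ cong (λ h → 1 + x * h) (sym (horner-+ (n C_) (λ i → n C suc i) (suc n) x)) ⟩
    1 + x * horner (λ i → n C i + n C suc i) (suc n) x
      ≡⟨ cong (λ h → 1 + x * h) (horner-cong (suc n) x (nCk+nC[k+1]≡[n+1]C[k+1] n)) ⟩
    horner (suc n C_) (suc (suc n)) x        ∎
    where
      E = horner (λ i → n C suc i) n x
      ring : ∀ x e y → (1 + x) * (1 + x * e) ≡ 1 + x * ((1 + x * e) + (e + 0 * y))
      ring = solve 3 (λ x e y → (con 1 :+ x) :* (con 1 :+ x :* e) := con 1 :+ x :* ((con 1 :+ x :* e) :+ (e :+ con 0 :* y))) refl

  absorption : ∀ n k → suc k * (suc n C suc k) ≡ suc n * (n C k)
  absorption zero    zero    = refl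
  absorption zero    (suc k) = *-zeroʳ (suc (suc k))
  absorption (suc n) zero    = trans (*-identityˡ _) (trans (nC1≡n (suc (suc n))) (sym (*-identityʳ _)))
  absorption (suc n) (suc k) = begin
    suc (suc k) * (suc (suc n) C suc (suc k))  ≡⟨ cong (suc (suc k) *_) (sym (nCk+nC[k+1]≡[n+1]C[k+1] (suc n) (suc k))) ⟩
    suc (suc k) * (A + B)                      ≡⟨ *-distribˡ-+ (suc (suc k)) A B ⟩
    suc (suc k) * A + suc (suc k) * B          ≡⟨ cong₂ (λ u v → A + u + v) (absorption n k) (absorption n (suc k)) ⟩
    A + suc n * (n C k) + suc n * (n C suc k)  ≡⟨ ring A (n C k) (n C suc k) n ⟩
    A + suc n * (n C k + n C suc k)            ≡⟨ cong (λ c → A + suc n * c) (nCk+nC[k+1]≡[n+1]C[k+1] n k) ⟩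
    suc (suc n) * A                            ∎
    where
      A = suc n C suc k
      B = suc n C suc (suc k)
      ring : ∀ a x y n → a + suc n * x + suc n * y ≡ a + suc n * (x + y)
      ring = solve 4 (λ a x y n → a :+ (con 1 :+ n) :* x :+ (con 1 :+ n) :* y := a :+ (con 1 :+ n) :* (x :+ y)) refl

  prime∣pCk : ∀ {p} → Prime p → ∀ k → 0 < k → k < p → p ∣ p C k
  prime∣pCk {suc n} pr (suc k) _ k<p =
    coprime-divisor (prime⇒coprime pr k<p) (divides (n C k) (trans (absorption n k) (*-comm (suc n) (n C k))))

  frobenius : ∀ {p} → Prime p → ∀ x → ∃[ m ] (1 + x) ^ p ≡ 1 + x ^ p + m * p
  frobenius {p@(suc n)} pr x
    with horner-∣ (λ i → p C suc i) n x (λ i i<n → prime∣pCk pr (suc i) z<s (s<s i<n))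
  ... | divides m middle≡mp = x * m , (begin
    (1 + x) ^ p                                               ≡⟨ binomial p x ⟩
    1 + x * horner (λ i → p C suc i) p x                      ≡⟨ cong (λ h → 1 + x * h) (horner-∷ʳ (λ i → p C suc i) n x) ⟩
    1 + x * (horner (λ i → p C suc i) n x + (p C p) * x ^ n)  ≡⟨ cong₂ (λ a c → 1 + x * (a + c * x ^ n)) middle≡mp (nCn≡1 p) ⟩
    1 + x * (m * p + 1 * x ^ n)                               ≡⟨ ring x m p (x ^ n) ⟩
    1 + x ^ p + x * m * p                                     ∎)
    where ring : ∀ x m p y → 1 + x * (m * p + 1 * y) ≡ 1 + x * y + x * m * p
          ring = solve 4 (λ x m p y → con 1 :+ x :* (m :* p :+ con 1 :* y) := con 1 :+ x :* y :+ x :* m :* p) refl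

  fermat : ∀ {p} → Prime p → ∀ a → ∃[ t ] a ^ p ≡ a + t * p
  fermat {suc n} pr zero    = 0 , *-zeroˡ (0 ^ n)
  fermat {p}     pr (suc a) with fermat pr a | frobenius pr a
  ... | t , aᵖ≡a+tp | m , frob = t + m , (begin
    (1 + a) ^ p             ≡⟨ frob ⟩
    1 + a ^ p + m * p       ≡⟨ cong (λ z → 1 + z + m * p) aᵖ≡a+tp ⟩
    1 + (a + t * p) + m * p ≡⟨ ring a t m p ⟩
    suc a + (t + m) * p     ∎)
    where ring : ∀ a t m p → 1 + (a + t * p) + m * p ≡ 1 + a + (t + m) * p
          ring = solve 4 (λ a t m p → con 1 :+ (a :+ t :* p) :+ m :* p := con 1 :+ a :+ (t :+ m) :* p) refl

module Lifting where

  open import Data.Nat.Base as ℕ using (ℕ; zero; suc; NonZero)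
  import Data.Nat.Properties as ℕ
  open import Data.Nat.Divisibility
    using (_∣_; divides; ∣-refl; ∣-trans; _∣0; n∣m*n; m∣m*n; ∣m⇒∣m*n; *-monoˡ-∣; *-monoʳ-∣)
  open import Data.Nat.Primality using (Prime; prime[2]; prime⇒nonZero)
  open import Data.Integer.Base using (+_; _+_; _-_; _*_; _^_; 0ℤ; 1ℤ)
  open import Data.Integer.Properties using (pos-+; pos-*; *-cancelˡ-≡; ^-*-assoc; ^-identityʳ; *-identityʳ; +-identityˡ; *-identityˡ)
  open import Data.Integer.Tactic.RingSolver using (solve-∀)
  open import Data.Product.Base using (∃-syntax; _,_; _×_)
  open import Relation.Binary.PropositionalEquality
  open import Relation.Nullary.Decidable using (yes; no)
  open import Relation.Nullary.Negation using (¬_; contradiction)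

  open Arithmetic
  open Congruence
  open Fermat using (fermat)

  binomial-quadratic : ∀ y r → ∃[ K ] (1ℤ + y) ^ r ≡ 1ℤ + y * + r + y * y * (+ triangular r + y * K)
  binomial-quadratic y zero    = 0ℤ , ring y
    where ring : ∀ y → 1ℤ ≡ 1ℤ + y * 0ℤ + y * y * (0ℤ + y * 0ℤ)
          ring = solve-∀
  binomial-quadratic y (suc r) with binomial-quadratic y r
  ... | K , expand = K + + T + y * K , (begin
    (1ℤ + y) * (1ℤ + y) ^ r                               ≡⟨ cong ((1ℤ + y) *_) expand ⟩
    (1ℤ + y) * (1ℤ + y * + r + y * y * (+ T + y * K))     ≡⟨ ring y (+ r) (+ T) K ⟩
    1ℤ + y * (1ℤ + + r) + y * y * ((+ T + + r) + y * (K + + T + y * K))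
      ≡⟨ cong₂ (λ a b → 1ℤ + y * a + y * y * (b + y * (K + + T + y * K))) (sym (pos-+ 1 r)) (sym (pos-+ T r)) ⟩
    1ℤ + y * + suc r + y * y * (+ triangular (suc r) + y * (K + + T + y * K)) ∎)
    where
      open ≡-Reasoning
      T = triangular r
      ring : ∀ y R T K → (1ℤ + y) * (1ℤ + y * R + y * y * (T + y * K)) ≡
                         1ℤ + y * (1ℤ + R) + y * y * ((T + R) + y * (K + T + y * K))
      ring = solve-∀

  ≡1+multiple⇒mod : ∀ a c n → a ≡ 1 ℕ.+ c ℕ.* n → + a ≡ 1ℤ [mod n ]
  ≡1+multiple⇒mod a c n refl = congruent (+ c) (pos-+-multiple 1 c n)

  fermat-mod : ∀ {p} → Prime p → ∀ a → (+ a) ^ p ≡ + a [mod p ]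
  fermat-mod {p} pr a with fermat pr a
  ... | t , aᵖ≡a+tp = congruent (+ t) (trans (sym (pos-^ a p)) (trans (cong +_ aᵖ≡a+tp) (pos-+-multiple a t p)))

  fermat-unit : ∀ {p} → Prime p → ∀ u → ¬ p ∣ u → (+ u) ^ (p ℕ.∸ 1) ≡ 1ℤ [mod p ]
  fermat-unit {suc n} pr u p∤u =
    mod-cancel {a = + u} pr (λ u≡0 → p∤u (mod0⇒∣ u≡0)) (mod-trans (fermat-mod pr u) (mod-reflexive (sym (*-identityʳ (+ u)))))

  ^-lift : ∀ {p P x} → p ∣ P → x ≡ 1ℤ [mod P ] → x ^ p ≡ 1ℤ [mod P ℕ.* p ]
  ^-lift {p} (divides q refl) (congruent t refl) with binomial-quadratic (t * (+ q * + p)) p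
  ... | K , expand = congruent w (begin
    (1ℤ + t * + (q ℕ.* p)) ^ p                       ≡⟨ cong (λ z → (1ℤ + t * z) ^ p) (pos-* q p) ⟩
    (1ℤ + y) ^ p                                     ≡⟨ expand ⟩
    1ℤ + y * + p + y * y * (+ triangular p + y * K)  ≡⟨ ring t (+ q) (+ p) (+ triangular p) K ⟩
    1ℤ + w * (+ q * + p * + p)                       ≡⟨ cong (λ z → 1ℤ + w * z) (sym (pos-*-* q p p)) ⟩
    1ℤ + w * + (q ℕ.* p ℕ.* p)                       ∎)
    where
      open ≡-Reasoning
      y = t * (+ q * + p)
      w = t + t * t * + q * (+ triangular p + y * K)
      ring : ∀ t q p T K → 1ℤ + t * (q * p) * p + t * (q * p) * (t * (q * p)) * (T + t * (q * p) * K) ≡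
                           1ℤ + (t + t * t * q * (T + t * (q * p) * K)) * (q * p * p)
      ring = solve-∀

  ^-lift-iterated : ∀ {p P x} → p ∣ P → x ≡ 1ℤ [mod P ] → ∀ i → x ^ (p ℕ.^ i) ≡ 1ℤ [mod P ℕ.* p ℕ.^ i ]
  ^-lift-iterated {p} {P} {x} p∣P x≡1 zero =
    subst (λ n → x ^ 1 ≡ 1ℤ [mod n ]) (sym (ℕ.*-identityʳ P)) (mod-trans (mod-reflexive (^-identityʳ x)) x≡1)
  ^-lift-iterated {p} {P} {x} p∣P x≡1 (suc i) =
    subst (λ n → x ^ (p ℕ.^ suc i) ≡ 1ℤ [mod n ]) (ℕ.*-assoc P p (p ℕ.^ i))
      (mod-trans (mod-reflexive (sym (^-*-assoc x p (p ℕ.^ i))))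
        (^-lift-iterated (n∣m*n P) (^-lift p∣P x≡1) i))

  odd-square≡1 : ∀ u → ¬ 2 ∣ u → (+ u) ^ 2 ≡ 1ℤ [mod 8 ]
  odd-square≡1 u 2∤u with odd⇒≡1+2* u 2∤u
  ... | t , refl = mod-trans (mod-reflexive (sym (pos-^ (1 ℕ.+ 2 ℕ.* t) 2)))
                             (≡1+multiple⇒mod _ (triangular (suc t)) 8 square≡)
    where
      square≡ : (1 ℕ.+ 2 ℕ.* t) ℕ.^ 2 ≡ 1 ℕ.+ triangular (suc t) ℕ.* 8
      square≡ = begin
        (1 ℕ.+ 2 ℕ.* t) ℕ.^ 2                ≡⟨ ring t ⟩
        1 ℕ.+ 4 ℕ.* (suc t ℕ.* t)            ≡⟨ cong (λ z → 1 ℕ.+ 4 ℕ.* z) (sym (2*triangular t)) ⟩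
        1 ℕ.+ 4 ℕ.* (2 ℕ.* triangular (suc t)) ≡⟨ cong (1 ℕ.+_) (ringℕ (triangular (suc t))) ⟩
        1 ℕ.+ triangular (suc t) ℕ.* 8       ∎
        where
          open ≡-Reasoning
          open import Data.Nat.Solver using (module +-*-Solver)
          open +-*-Solver using (solve; _:+_; _:*_; _:^_; _:=_; con)
          ring : ∀ t → (1 ℕ.+ 2 ℕ.* t) ℕ.^ 2 ≡ 1 ℕ.+ 4 ℕ.* (suc t ℕ.* t)
          ring = solve 1 (λ t → (con 1 :+ con 2 :* t) :^ 2 := con 1 :+ con 4 :* ((con 1 :+ t) :* t)) refl
          ringℕ : ∀ T → 4 ℕ.* (2 ℕ.* T) ≡ T ℕ.* 8
          ringℕ = solve 1 (λ T → con 4 :* (con 2 :* T) := T :* con 8) refl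

  odd-prime-power-exponent : ∀ {p} → Prime p → ∀ u → ¬ p ∣ u → ∀ i →
                             (+ u) ^ ((p ℕ.∸ 1) ℕ.* p ℕ.^ i) ≡ 1ℤ [mod p ℕ.^ suc i ]
  odd-prime-power-exponent {p} pr u p∤u i =
    mod-trans (mod-reflexive (sym (^-*-assoc (+ u) (p ℕ.∸ 1) (p ℕ.^ i))))
              (^-lift-iterated ∣-refl (fermat-unit pr u p∤u) i)

  two-power-exponent : ∀ u → ¬ 2 ∣ u → ∀ i → (+ u) ^ (2 ℕ.^ suc i) ≡ 1ℤ [mod 2 ℕ.^ (3 ℕ.+ i) ]
  two-power-exponent u 2∤u i =
    subst (λ n → (+ u) ^ (2 ℕ.^ suc i) ≡ 1ℤ [mod n ]) (sym (ℕ.^-distribˡ-+-* 2 3 i))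
      (mod-trans (mod-reflexive (sym (^-*-assoc (+ u) 2 (2 ℕ.^ i))))
                 (^-lift-iterated (divides 4 refl) (odd-square≡1 u 2∤u) i))

  -- p ∣ Q · triangular p makes the quadratic term of the binomial expansion divisible by Q p²;
  -- it holds for odd p, and for p = 2 when Q is even.
  exact-lift : ∀ {p} Q {w} → p ∣ Q ℕ.* triangular p → w ≡ 1ℤ [mod p ] →
               ∃[ w′ ] ((1ℤ + w * + (Q ℕ.* p)) ^ p ≡ 1ℤ + w′ * + (Q ℕ.* p ℕ.* p)) × (w′ ≡ 1ℤ [mod p ])
  exact-lift {p} Q {w} (divides c QT≡cp) w≡1 with binomial-quadratic (w * (+ Q * + p)) p
  ... | K , expand = w′ , (begin
    (1ℤ + w * + (Q ℕ.* p)) ^ p                ≡⟨ cong (λ z → (1ℤ + w * z) ^ p) (pos-* Q p) ⟩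
    (1ℤ + y) ^ p                              ≡⟨ expand ⟩
    1ℤ + y * + p + y * y * (+ T + y * K)      ≡⟨ ring₁ w (+ Q) (+ p) (+ T) K ⟩
    1ℤ + w * (+ Q * + p * + p) + w * w * + Q * + p * + p * (+ Q * + T) + y * y * y * K
      ≡⟨ cong (λ z → 1ℤ + w * (+ Q * + p * + p) + w * w * + Q * + p * + p * z + y * y * y * K) QT≡cp′ ⟩
    1ℤ + w * (+ Q * + p * + p) + w * w * + Q * + p * + p * (+ c * + p) + y * y * y * K
      ≡⟨ ring₂ w (+ Q) (+ p) (+ c) K ⟩
    1ℤ + w′ * (+ Q * + p * + p)               ≡⟨ cong (λ z → 1ℤ + w′ * z) (sym (pos-*-* Q p p)) ⟩
    1ℤ + w′ * + (Q ℕ.* p ℕ.* p)               ∎) , mod-trans (congruent m refl) w≡1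
    where
      open ≡-Reasoning
      T = triangular p
      y = w * (+ Q * + p)
      m = w * w * + c + w * w * + Q * w * + Q * K
      w′ = w + m * + p
      QT≡cp′ : + Q * + T ≡ + c * + p
      QT≡cp′ = trans (sym (pos-* Q T)) (trans (cong +_ QT≡cp) (pos-* c p))
      ring₁ : ∀ w Q p T K → 1ℤ + w * (Q * p) * p + w * (Q * p) * (w * (Q * p)) * (T + w * (Q * p) * K) ≡
              1ℤ + w * (Q * p * p) + w * w * Q * p * p * (Q * T) + w * (Q * p) * (w * (Q * p)) * (w * (Q * p)) * K
      ring₁ = solve-∀
      ring₂ : ∀ w Q p c K →
              1ℤ + w * (Q * p * p) + w * w * Q * p * p * (c * p) + w * (Q * p) * (w * (Q * p)) * (w * (Q * p)) * K ≡
              1ℤ + (w + (w * w * c + w * w * Q * w * Q * K) * p) * (Q * p * p)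
      ring₂ = solve-∀

  exact-lift-iterated : ∀ {p} Q {w} → p ∣ Q ℕ.* triangular p → w ≡ 1ℤ [mod p ] → ∀ j →
    ∃[ w′ ] ((1ℤ + w * + (Q ℕ.* p)) ^ (p ℕ.^ j) ≡ 1ℤ + w′ * + (Q ℕ.* p ℕ.^ j ℕ.* p)) × (w′ ≡ 1ℤ [mod p ])
  exact-lift-iterated {p} Q {w} _ w≡1 zero =
    w , trans (^-identityʳ _) (cong (λ n → 1ℤ + w * + (n ℕ.* p)) (sym (ℕ.*-identityʳ Q))) , w≡1
  exact-lift-iterated {p} Q {w} p∣QT w≡1 (suc j) =
    let w₁ , xᵖ≡ , w₁≡1 = exact-lift Q p∣QT w≡1
        w′ , expand , w′≡1 = exact-lift-iterated (Q ℕ.* p) (∣m⇒∣m*n (triangular p) (n∣m*n Q)) w₁≡1 j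
    in w′ , (begin
    x ^ (p ℕ.* p ℕ.^ j)                           ≡⟨ sym (^-*-assoc x p (p ℕ.^ j)) ⟩
    (x ^ p) ^ (p ℕ.^ j)                           ≡⟨ cong (_^ (p ℕ.^ j)) xᵖ≡ ⟩
    (1ℤ + w₁ * + (Q ℕ.* p ℕ.* p)) ^ (p ℕ.^ j)     ≡⟨ expand ⟩
    1ℤ + w′ * + (Q ℕ.* p ℕ.* p ℕ.^ j ℕ.* p)       ≡⟨ cong (λ n → 1ℤ + w′ * + (n ℕ.* p)) (ℕ.*-assoc Q p (p ℕ.^ j)) ⟩
    1ℤ + w′ * + (Q ℕ.* p ℕ.^ suc j ℕ.* p)         ∎) , w′≡1
    where open ≡-Reasoning
          x = 1ℤ + w * + (Q ℕ.* p)

  power-of-1+multiple : ∀ {p} P w r → p ∣ P → w ≡ 1ℤ [mod p ] →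
                        ∃[ Z ] ((1ℤ + w * + P) ^ r ≡ 1ℤ + + P * Z) × (Z ≡ + r [mod p ])
  power-of-1+multiple {p} P w r p∣P w≡1 with binomial-quadratic (w * + P) r
  ... | K , expand = Z , trans expand (sym (ring w (+ P) (+ r) (+ triangular r) K)) , Z≡r
    where
      s = w * w * (+ triangular r + w * + P * K)
      Z = w * + r + + P * s
      ring : ∀ w P r T K → 1ℤ + P * (w * r + P * (w * w * (T + w * P * K))) ≡
                           1ℤ + w * P * r + w * P * (w * P) * (T + w * P * K)
      ring = solve-∀
      Z≡r : Z ≡ + r [mod p ]
      Z≡r = begin
        Z                      ≈⟨ mod-+ (mod-refl (w * + r)) (mod-* (∣⇒mod0 {a = + P} p∣P) (mod-refl s)) ⟩
        w * + r + 0ℤ * s       ≡⟨ ring′ (w * + r) s ⟩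
        w * + r                ≈⟨ mod-* w≡1 (mod-refl (+ r)) ⟩
        1ℤ * + r               ≡⟨ *-identityˡ (+ r) ⟩
        + r                    ∎
        where open ≡-mod-Reasoning p
              ring′ : ∀ a s → a + 0ℤ * s ≡ a
              ring′ = solve-∀

  power-of-1+multiple≢1 : ∀ {p} P {w r} .{{_ : NonZero P}} → p ∣ P → w ≡ 1ℤ [mod p ] → ¬ p ∣ r →
                          ¬ ((1ℤ + w * + P) ^ r ≡ 1ℤ [mod P ℕ.* p ])
  power-of-1+multiple≢1 {p} P {w} {r} p∣P w≡1 p∤r (congruent t eq) with power-of-1+multiple P w r p∣P w≡1
  ... | Z , expand , Z≡r = p∤r (mod0⇒∣ (mod-trans (mod-sym Z≡r) (congruent t (trans Z≡tp (sym (+-identityˡ (t * + p)))))))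
    where
      1+PZ≡1+Ptp : 1ℤ + + P * Z ≡ 1ℤ + + P * (t * + p)
      1+PZ≡1+Ptp = begin
        1ℤ + + P * Z           ≡⟨ expand ⟨
        (1ℤ + w * + P) ^ r     ≡⟨ eq ⟩
        1ℤ + t * + (P ℕ.* p)   ≡⟨ cong (λ z → 1ℤ + t * z) (pos-* P p) ⟩
        1ℤ + t * (+ P * + p)   ≡⟨ ring t (+ P) (+ p) ⟩
        1ℤ + + P * (t * + p)   ∎
        where
          open ≡-Reasoning
          ring : ∀ t P p → 1ℤ + t * (P * p) ≡ 1ℤ + P * (t * p)
          ring = solve-∀
      cancel-1+ : ∀ {a b} → 1ℤ + a ≡ 1ℤ + b → a ≡ b
      cancel-1+ {a} {b} eq = trans (ring a) (trans (cong (_- 1ℤ) eq) (sym (ring b)))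
        where ring : ∀ a → a ≡ 1ℤ + a - 1ℤ
              ring = solve-∀
      Z≡tp : Z ≡ t * + p
      Z≡tp = *-cancelˡ-≡ (+ P) Z (t * + p) (cancel-1+ 1+PZ≡1+Ptp)

  -- x^(pᵃ) ≡ 1 holds modulo Q pᵃ⁺¹ but not modulo Q pᵃ⁺², so x has order pᵉ modulo Q pᵉ⁺¹.
  order-bound : ∀ {p} Q {w} .{{_ : NonZero Q}} → Prime p → p ∣ Q ℕ.* triangular p → w ≡ 1ℤ [mod p ] →
                ∀ N e → (1ℤ + w * + (Q ℕ.* p)) ^ N ≡ 1ℤ [mod Q ℕ.* p ℕ.^ e ℕ.* p ] → p ℕ.^ e ∣ N
  order-bound Q pr p∣QT w≡1 zero e _ = _ ∣0
  order-bound {p} Q {w} pr p∣QT w≡1 N@(suc _) e xᴺ≡1 with split-power p (prime>1 pr) N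
  ... | a , r , N≡pᵃr , p∤r with e ℕ.≤? a
  ...   | yes e≤a = ∣-trans (^-monoʳ-∣ p e≤a) (subst (p ℕ.^ a ∣_) (sym N≡pᵃr) (m∣m*n r))
  ...   | no  e≰a with exact-lift-iterated Q p∣QT w≡1 a
  ...     | wₐ , xᵖᵃ≡ , wₐ≡1 =
    contradiction (mod-divisor Pp∣modulus (mod-trans (mod-reflexive (sym xᴺ≡)) xᴺ≡1))
                  (power-of-1+multiple≢1 P (n∣m*n (Q ℕ.* p ℕ.^ a)) wₐ≡1 p∤r)
    where
      open ≡-Reasoning
      x = 1ℤ + w * + (Q ℕ.* p)
      P = Q ℕ.* p ℕ.^ a ℕ.* p
      instance
        _ : NonZero p
        _ = prime⇒nonZero pr
        _ : NonZero (p ℕ.^ a)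
        _ = ℕ.m^n≢0 p a
        _ : NonZero (Q ℕ.* p ℕ.^ a)
        _ = ℕ.m*n≢0 Q (p ℕ.^ a)
        _ : NonZero P
        _ = ℕ.m*n≢0 (Q ℕ.* p ℕ.^ a) p
      xᴺ≡ : x ^ N ≡ (1ℤ + wₐ * + P) ^ r
      xᴺ≡ = begin
        x ^ N                  ≡⟨ cong (x ^_) N≡pᵃr ⟩
        x ^ (p ℕ.^ a ℕ.* r)    ≡⟨ ^-*-assoc x (p ℕ.^ a) r ⟨
        (x ^ (p ℕ.^ a)) ^ r    ≡⟨ cong (_^ r) xᵖᵃ≡ ⟩
        (1ℤ + wₐ * + P) ^ r    ∎
      Pp∣modulus : P ℕ.* p ∣ Q ℕ.* p ℕ.^ e ℕ.* p
      Pp∣modulus = *-monoˡ-∣ p (subst (_∣ Q ℕ.* p ℕ.^ e) P≡Qpᵃ⁺¹ (*-monoʳ-∣ Q (^-monoʳ-∣ p (ℕ.≰⇒> e≰a))))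
        where P≡Qpᵃ⁺¹ : Q ℕ.* p ℕ.^ suc a ≡ P
              P≡Qpᵃ⁺¹ = trans (cong (Q ℕ.*_) (ℕ.*-comm p (p ℕ.^ a))) (sym (ℕ.*-assoc Q (p ℕ.^ a) p))

  odd-prime-order-bound : ∀ {p} → Prime p → ¬ 2 ∣ p → ∀ N e →
                          (+ suc p) ^ N ≡ 1ℤ [mod p ℕ.^ suc e ] → p ℕ.^ e ∣ N
  odd-prime-order-bound {p} pr 2∤p N e 1+pᴺ≡1 with odd⇒≡1+2* p 2∤p
  ... | h , p≡1+2h = order-bound 1 pr p∣T (mod-refl 1ℤ) N e
    (subst₂ (λ x n → x ^ N ≡ 1ℤ [mod n ]) base≡ modulus≡ 1+pᴺ≡1)
    where
      base≡ : + suc p ≡ 1ℤ + 1ℤ * + (1 ℕ.* p)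
      base≡ = cong (λ z → 1ℤ + z) (sym (trans (*-identityˡ _) (cong +_ (ℕ.*-identityˡ p))))
      modulus≡ : p ℕ.^ suc e ≡ 1 ℕ.* p ℕ.^ e ℕ.* p
      modulus≡ = trans (ℕ.*-comm p (p ℕ.^ e)) (cong (ℕ._* p) (sym (ℕ.*-identityˡ (p ℕ.^ e))))
      p∣T : p ∣ 1 ℕ.* triangular p
      p∣T = divides h (trans (ℕ.*-identityˡ _) (trans (cong triangular p≡1+2h)
              (trans (triangular-odd h) (trans (ℕ.*-comm _ h) (cong (h ℕ.*_) (sym p≡1+2h))))))

  five-order-bound : ∀ N e → (+ 5) ^ N ≡ 1ℤ [mod 2 ℕ.^ (2 ℕ.+ e) ] → 2 ℕ.^ e ∣ N
  five-order-bound N e 5ᴺ≡1 = order-bound 2 prime[2] (divides 1 refl) (mod-refl 1ℤ) N e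
    (subst (λ n → (+ 5) ^ N ≡ 1ℤ [mod n ]) (ℕ.*-comm 2 (2 ℕ.* 2 ℕ.^ e)) 5ᴺ≡1)

module PolynomialRoots where

  open import Data.Nat.Base as ℕ using (ℕ; zero; suc; NonZero; z≤n; s≤s; _<_; _≤_)
  import Data.Nat.Properties as ℕ
  open import Data.Nat.Divisibility using (_∣_; ∣⇒≤; ∣1⇒≡1)
  open import Data.Nat.DivMod using (m<n⇒m%n≡m)
  open import Data.Nat.GCD using (gcd; gcd-GCD; gcd[m,n]∣m; gcd[m,n]∣n; gcd[m,n]≡0⇒n≡0; module Bézout)
  open import Data.Nat.Primality using (Prime)
  open import Data.Integer.Base using (ℤ; +_; _+_; _*_; _-_; -_; _^_; 0ℤ; 1ℤ)
  open import Data.Integer.Properties using (^-*-assoc; ^-zeroˡ; ^-distribˡ-+-*; *-identityʳ; +-identityˡ)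
  open import Data.Integer.Tactic.RingSolver using (solve-∀)
  open import Data.List.Base using (List; []; _∷_; length; replicate; applyUpTo)
  open import Data.List.Properties using (length-replicate; length-applyUpTo)
  open import Data.List.Relation.Unary.All using (All; []; _∷_)
  import Data.List.Relation.Unary.All.Properties as All
  open import Data.List.Relation.Unary.AllPairs using (AllPairs; []; _∷_)
  import Data.List.Relation.Unary.AllPairs.Properties as AllPairs
  open import Data.Sum.Base using (inj₁; inj₂)
  open import Relation.Binary.PropositionalEquality
  open import Relation.Nullary.Negation using (¬_; contradiction)

  open Arithmetic using (prime>1)
  open Congruence
  open Lifting using (fermat-unit)

  -- A list c₀ ∷ … ∷ c_{d-1} stands for the monic polynomial c₀ + c₁ x + … + c_{d-1} x^{d-1} + x^d.
  evalMonic : List ℤ → ℤ → ℤ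
  evalMonic []       x = 1ℤ
  evalMonic (c ∷ cs) x = c + x * evalMonic cs x

  divideByRoot : List ℤ → ℤ → List ℤ
  divideByRoot []            r = []
  divideByRoot (c ∷ [])      r = []
  divideByRoot (c ∷ c′ ∷ cs) r = evalMonic (c′ ∷ cs) r ∷ divideByRoot (c′ ∷ cs) r

  remainder-theorem : ∀ c cs r x →
    evalMonic (c ∷ cs) x ≡ (x - r) * evalMonic (divideByRoot (c ∷ cs) r) x + evalMonic (c ∷ cs) r
  remainder-theorem c []        r x = ring c r x
    where ring : ∀ c r x → c + x * 1ℤ ≡ (x - r) * 1ℤ + (c + r * 1ℤ)
          ring = solve-∀
  remainder-theorem c (c′ ∷ cs) r x =
    trans (cong (λ q → c + x * q) (remainder-theorem c′ cs r x))
          (ring c x r (evalMonic (c′ ∷ cs) r) (evalMonic (divideByRoot (c′ ∷ cs) r) x))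
    where ring : ∀ c x r a q → c + x * ((x - r) * q + a) ≡ (x - r) * (a + x * q) + (c + r * a)
          ring = solve-∀

  length-divideByRoot : ∀ c cs r → length (divideByRoot (c ∷ cs) r) ≡ length cs
  length-divideByRoot c []        r = refl
  length-divideByRoot c (c′ ∷ cs) r = cong suc (length-divideByRoot c′ cs r)

  1≢0-mod-prime : ∀ {p} → Prime p → ¬ (1ℤ ≡ 0ℤ [mod p ])
  1≢0-mod-prime pr 1≡0 = ℕ.<⇒≢ (prime>1 pr) (sym (∣1⇒≡1 (mod0⇒∣ 1≡0)))

  roots-≤-degree : ∀ {p} → Prime p → ∀ (rs : List ℤ) cs →
                   AllPairs (λ a b → ¬ (a ≡ b [mod p ])) rs → All (λ r → evalMonic cs r ≡ 0ℤ [mod p ]) rs →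
                   length rs ≤ length cs
  roots-≤-degree pr []       cs       _         _          = z≤n
  roots-≤-degree pr (r ∷ rs) []       _         (r-root ∷ _) = contradiction r-root (1≢0-mod-prime pr)
  roots-≤-degree {p} pr (r ∷ rs) (c ∷ cs) (r≢rs ∷ distinct) (r-root ∷ roots) =
    s≤s (subst (length rs ≤_) (length-divideByRoot c cs r)
          (roots-≤-degree pr rs (divideByRoot (c ∷ cs) r) distinct (quotient-roots rs r≢rs roots)))
    where
      f = c ∷ cs
      q = divideByRoot f r
      quotient-root : ∀ {s} → ¬ (r ≡ s [mod p ]) → evalMonic f s ≡ 0ℤ [mod p ] → evalMonic q s ≡ 0ℤ [mod p ]
      quotient-root {s} r≢s s-root
        with mod-euclid pr (mod-trans (mod-reflexive (trans (ring (s - r) (evalMonic q s) (evalMonic f r))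
                                                           (cong (_- evalMonic f r) (sym (remainder-theorem c cs r s)))))
                                      (mod-difference (mod-trans s-root (mod-sym r-root))))
        where ring : ∀ a b c → a * b ≡ a * b + c - c
              ring = solve-∀
      ... | inj₁ s-r≡0 = contradiction (mod-sym (difference-mod s-r≡0)) r≢s
      ... | inj₂ q[s]≡0 = q[s]≡0
      quotient-roots : ∀ ss → All (λ s → ¬ (r ≡ s [mod p ])) ss → All (λ s → evalMonic f s ≡ 0ℤ [mod p ]) ss →
                       All (λ s → evalMonic q s ≡ 0ℤ [mod p ]) ss
      quotient-roots []       []           []             = []
      quotient-roots (s ∷ ss) (r≢s ∷ r≢ss) (s-root ∷ ss-roots) =
        quotient-root r≢s s-root ∷ quotient-roots ss r≢ss ss-roots

  evalMonic-replicate-0 : ∀ m x → evalMonic (replicate m 0ℤ) x ≡ x ^ m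
  evalMonic-replicate-0 zero    x = refl
  evalMonic-replicate-0 (suc m) x = trans (+-identityˡ _) (cong (x *_) (evalMonic-replicate-0 m x))

  residues-distinct : ∀ {p a b} .{{_ : NonZero p}} → a < p → b < p → + a ≡ + b [mod p ] → a ≡ b
  residues-distinct {p} {a} {b} a<p b<p a≡b = trans (sym (m<n⇒m%n≡m a<p)) (trans (mod⇒%≡% a b p a≡b) (m<n⇒m%n≡m b<p))

  nonzero-residues-roots⇒≤ : ∀ {p} → Prime p → ∀ g → (∀ x → 0 < x → x < p → (+ x) ^ suc g ≡ 1ℤ [mod p ]) →
                             p ℕ.∸ 1 ≤ suc g
  nonzero-residues-roots⇒≤ {p@(suc (suc n))} pr g all-roots =
    subst₂ _≤_ (length-applyUpTo residue (suc n)) (cong suc (length-replicate g))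
      (roots-≤-degree pr (applyUpTo residue (suc n)) xᵍ⁺¹-1
        (AllPairs.applyUpTo⁺₁ residue (suc n) (λ i<j j<n+1 i≡j → ℕ.<⇒≢ i<j (ℕ.suc-injective
           (residues-distinct (s≤s (ℕ.<-trans i<j j<n+1)) (s≤s j<n+1) i≡j))))
        (All.applyUpTo⁺₁ residue (suc n) (λ {i} i<n+1 → root (suc i) (s≤s z≤n) (s≤s i<n+1))))
    where
      residue : ℕ → ℤ
      residue i = + suc i
      xᵍ⁺¹-1 = - 1ℤ ∷ replicate g 0ℤ
      root : ∀ x → 0 < x → x < p → evalMonic xᵍ⁺¹-1 (+ x) ≡ 0ℤ [mod p ]
      root x 0<x x<p = mod-trans (mod-reflexive (trans (cong (λ y → - 1ℤ + + x * y) (evalMonic-replicate-0 g (+ x)))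
                                                       (ring (+ x) ((+ x) ^ g))))
                                 (mod-difference (all-roots x 0<x x<p))
        where ring : ∀ y z → - 1ℤ + y * z ≡ y * z - 1ℤ
              ring = solve-∀

  ^-multiple≡1 : ∀ {n X} c a → X ^ a ≡ 1ℤ [mod n ] → X ^ (c ℕ.* a) ≡ 1ℤ [mod n ]
  ^-multiple≡1 {X = X} c a Xᵃ≡1 =
    mod-trans (mod-reflexive (trans (cong (X ^_) (ℕ.*-comm c a)) (sym (^-*-assoc X a c))))
              (mod-trans (mod-^ c Xᵃ≡1) (mod-reflexive (^-zeroˡ c)))

  ^-+≡1 : ∀ {n X} d m → X ^ (d ℕ.+ m) ≡ 1ℤ [mod n ] → X ^ m ≡ 1ℤ [mod n ] → X ^ d ≡ 1ℤ [mod n ]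
  ^-+≡1 {X = X} d m Xᵈ⁺ᵐ≡1 Xᵐ≡1 =
    mod-trans (mod-reflexive (sym (*-identityʳ (X ^ d))))
      (mod-trans (mod-* (mod-refl (X ^ d)) (mod-sym Xᵐ≡1))
        (mod-trans (mod-reflexive (sym (^-distribˡ-+-* X d m))) Xᵈ⁺ᵐ≡1))

  ^-gcd≡1 : ∀ {n X} a b → X ^ a ≡ 1ℤ [mod n ] → X ^ b ≡ 1ℤ [mod n ] → X ^ gcd a b ≡ 1ℤ [mod n ]
  ^-gcd≡1 {n} {X} a b Xᵃ≡1 Xᵇ≡1 with Bézout.identity (gcd-GCD a b)
  ... | Bézout.+- x y g+yb≡xa =
    ^-+≡1 (gcd a b) (y ℕ.* b) (subst (λ e → X ^ e ≡ 1ℤ [mod n ]) (sym g+yb≡xa) (^-multiple≡1 x a Xᵃ≡1)) (^-multiple≡1 y b Xᵇ≡1)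
  ... | Bézout.-+ x y g+xa≡yb =
    ^-+≡1 (gcd a b) (x ℕ.* a) (subst (λ e → X ^ e ≡ 1ℤ [mod n ]) (sym g+xa≡yb) (^-multiple≡1 y b Xᵇ≡1)) (^-multiple≡1 x a Xᵃ≡1)

  -- Stands in for a primitive root: all p - 1 nonzero residues are roots of x^gcd(k, p-1) - 1.
  p-1∣exponent : ∀ {p} → Prime p → ∀ k → (∀ x → ¬ p ∣ x → (+ x) ^ k ≡ 1ℤ [mod p ]) → p ℕ.∸ 1 ∣ k
  p-1∣exponent {p@(suc (suc n))} pr k units-roots with gcd k (suc n) in g≡
  ... | zero  = contradiction (gcd[m,n]≡0⇒n≡0 k g≡) (λ ())
  ... | suc g = subst (_∣ k) g≡p-1 (subst (_∣ k) g≡ (gcd[m,n]∣m k (suc n)))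
    where
      g≡p-1 : suc g ≡ suc n
      g≡p-1 = ℕ.≤-antisym (subst (_≤ suc n) g≡ (∣⇒≤ (gcd[m,n]∣n k (suc n))))
        (nonzero-residues-roots⇒≤ pr g λ x 0<x x<p →
          let p∤x = λ p∣x → ℕ.<⇒≱ x<p (∣⇒≤ {{ℕ.>-nonZero 0<x}} p∣x) in
          subst (λ e → (+ x) ^ e ≡ 1ℤ [mod p ]) g≡ (^-gcd≡1 k (suc n) (units-roots x p∤x) (fermat-unit pr x p∤x)))

module Annihilator where

  open import Data.Nat.Base as ℕ using (ℕ; zero; suc; _≤_; _<_)
  import Data.Nat.Properties as ℕ
  open import Data.Nat.Divisibility
    using (_∣_; _∣?_; divides; ∣-refl; m∣m*n; n∣m*n; *-cancelˡ-∣; ∣1⇒≡1; ∣m+n∣m⇒∣n)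
  open import Data.Nat.Coprimality using (Coprime; coprime-+; prime⇒coprime)
  import Data.Nat.Coprimality as Coprime
  open import Data.Nat.Primality using (Prime; prime[2])
  open import Data.Integer.Base using (+_; _*_; _^_; 1ℤ)
  open import Data.Integer.Properties using (*-identityʳ; pos-*; pos-+)
  open import Data.Product.Base using (_×_; _,_)
  open import Relation.Binary.PropositionalEquality
  open import Relation.Nullary.Decidable using (yes; no; from-no)
  open import Relation.Nullary.Negation using (¬_; contradiction)

  open Arithmetic
  open Congruence
  open Lifting
  open PolynomialRoots using (p-1∣exponent; ^-multiple≡1)

  Annihilates : ℕ → ℕ → Set
  Annihilates k n = ∀ a → Coprime a n → (+ a) ^ k ≡ 1ℤ [mod n ]

  annihilates-1 : ∀ k → Annihilates k 1
  annihilates-1 k a _ = mod-1 _ _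

  annihilates-* : ∀ {k m n} → Coprime m n → Annihilates k m → Annihilates k n → Annihilates k (m ℕ.* n)
  annihilates-* {k} {m} {n} m⊥n ann-m ann-n a a⊥mn =
    mod-crt m⊥n (ann-m a (coprime-∣ a⊥mn (m∣m*n n))) (ann-n a (coprime-∣ a⊥mn (n∣m*n m)))

  -- For a unit b modulo m, m + b n is a unit modulo m n; take b = a and b = 1.
  annihilates-*⁻ : ∀ {k m n} → Coprime m n → Annihilates k (m ℕ.* n) → Annihilates k m
  annihilates-*⁻ {k} {m} {n} m⊥n ann a a⊥m = begin
    (+ a) ^ k                       ≡⟨ *-identityʳ _ ⟨
    (+ a) ^ k * 1ℤ                  ≈⟨ mod-* (mod-refl ((+ a) ^ k)) (mod-sym ([bn]ᵏ≡1 1 (Coprime.1-coprimeTo m))) ⟩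
    (+ a) ^ k * (+ (1 ℕ.* n)) ^ k   ≡⟨ cong (λ x → (+ a) ^ k * (+ x) ^ k) (ℕ.*-identityˡ n) ⟩
    (+ a) ^ k * (+ n) ^ k           ≡⟨ ^-distribʳ-* (+ a) (+ n) k ⟨
    (+ a * + n) ^ k                 ≡⟨ cong (_^ k) (pos-* a n) ⟨
    (+ (a ℕ.* n)) ^ k               ≈⟨ [bn]ᵏ≡1 a a⊥m ⟩
    1ℤ                              ∎
    where
      open ≡-mod-Reasoning m
      [bn]ᵏ≡1 : ∀ b → Coprime b m → (+ (b ℕ.* n)) ^ k ≡ 1ℤ [mod m ]
      [bn]ᵏ≡1 b b⊥m = mod-trans (mod-^ k (mod-sym m+bn≡bn)) (mod-divisor (m∣m*n n) (ann (m ℕ.+ b ℕ.* n) unit))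
        where
          m+bn≡bn : + (m ℕ.+ b ℕ.* n) ≡ + (b ℕ.* n) [mod m ]
          m+bn≡bn = mod-trans (mod-reflexive (pos-+ m (b ℕ.* n))) (mod-+ (∣⇒mod0 {a = + m} ∣-refl) (mod-refl (+ (b ℕ.* n))))
          unit : Coprime (m ℕ.+ b ℕ.* n) (m ℕ.* n)
          unit = coprime-* (coprime-+ (Coprime.sym (coprime-* (Coprime.sym b⊥m) m⊥n))) (coprime-+* b m⊥n)

  annihilates-2^⇒ : ∀ β M e → ¬ 2 ∣ M → Annihilates (2 ℕ.^ β ℕ.* M) (2 ℕ.^ e) → e ≤ 2 ℕ.+ β
  annihilates-2^⇒ β M e 2∤M ann with e ℕ.≤? 2 ℕ.+ β
  ... | yes e≤2+β = e≤2+β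
  ... | no  e≰2+β = contradiction (*-cancelˡ-∣ (2 ℕ.^ β) {{ℕ.m^n≢0 2 β}} 2^β*2∣2^β*M) 2∤M
    where
      5ᵏ≡1 : (+ 5) ^ (2 ℕ.^ β ℕ.* M) ≡ 1ℤ [mod 2 ℕ.^ (2 ℕ.+ suc β) ]
      5ᵏ≡1 = mod-divisor (^-monoʳ-∣ 2 (ℕ.≰⇒> e≰2+β)) (ann 5 (prime∤⇒coprime-^ prime[2] (from-no (2 ∣? 5)) e))
      2^β*2∣2^β*M : 2 ℕ.^ β ℕ.* 2 ∣ 2 ℕ.^ β ℕ.* M
      2^β*2∣2^β*M = subst (_∣ 2 ℕ.^ β ℕ.* M) (ℕ.*-comm 2 (2 ℕ.^ β)) (five-order-bound (2 ℕ.^ β ℕ.* M) (suc β) 5ᵏ≡1)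

  annihilates-2^⇐ : ∀ β M e → 0 < β → e ≤ 2 ℕ.+ β → Annihilates (2 ℕ.^ β ℕ.* M) (2 ℕ.^ e)
  annihilates-2^⇐ β       M zero    _   _     = annihilates-1 (2 ℕ.^ β ℕ.* M)
  annihilates-2^⇐ (suc i) M (suc e) _   e≤2+β a a⊥2ᵉ =
    mod-divisor (^-monoʳ-∣ 2 e≤2+β)
      (mod-trans (mod-reflexive (cong ((+ a) ^_) (ℕ.*-comm (2 ℕ.^ suc i) M)))
        (^-multiple≡1 M (2 ℕ.^ suc i) (two-power-exponent a (coprime-^suc⇒∤ prime[2] e a⊥2ᵉ) i)))

  annihilates-odd-prime^⇒ : ∀ {p} k i → Prime p → ¬ 2 ∣ p → Annihilates k (p ℕ.^ suc i) →
                            p ℕ.∸ 1 ∣ k × p ℕ.^ i ∣ k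
  annihilates-odd-prime^⇒ {p} k i pr 2∤p ann =
    p-1∣exponent pr k (λ x p∤x → mod-divisor (m∣m*n (p ℕ.^ i)) (ann x (prime∤⇒coprime-^ pr p∤x (suc i)))) ,
    odd-prime-order-bound pr 2∤p k i (ann (suc p) (prime∤⇒coprime-^ pr p∤1+p (suc i)))
    where p∤1+p : ¬ p ∣ suc p
          p∤1+p p∣1+p = ℕ.<⇒≢ (prime>1 pr) (sym (∣1⇒≡1 (∣m+n∣m⇒∣n (subst (p ∣_) (ℕ.+-comm 1 p) p∣1+p) ∣-refl)))

  annihilates-prime^⇐ : ∀ {p} k i → Prime p → p ℕ.∸ 1 ∣ k → p ℕ.^ i ∣ k → Annihilates k (p ℕ.^ suc i)
  annihilates-prime^⇐ {p@(suc (suc n))} k i pr p-1∣k pⁱ∣k a a⊥pⁱ⁺¹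
    with coprime⇒*∣ (coprime-^ (Coprime.sym (prime⇒coprime pr (ℕ.n<1+n (suc n)))) i) p-1∣k pⁱ∣k
  ... | divides c refl = ^-multiple≡1 c _ (odd-prime-power-exponent pr a (coprime-^suc⇒∤ pr i a⊥pⁱ⁺¹) i)

module UnitCount where

  open import Data.Nat.Base as ℕ using (ℕ; NonZero)
  open import Data.Nat.Properties using (_≟_)
  open import Data.Nat.DivMod using (_%_; m%n<n; m%n%n≡m%n)
  open import Data.Nat.Divisibility using (∣n∣m%n⇒∣m)
  open import Data.Nat.Coprimality using (Coprime; coprime?)
  open import Data.Integer.Base using (+_; _^_)
  open import Data.List.Base using (upTo; length)
  open import Data.List.Properties using (filter-complete; filter-all)
  open import Data.List.Relation.Unary.All as All using (All)
  open import Data.List.Relation.Unary.All.Properties using (all-filter)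
  open import Data.List.Membership.Propositional.Properties using (∈-filter⁺; ∈-filter⁻; ∈-upTo⁺)
  open import Data.Product.Base using (_,_; proj₂)
  open import Function.Bundles using (_⇔_; mk⇔)
  open import Relation.Binary.PropositionalEquality

  open import Defs
  open Congruence
  open Annihilator using (Annihilates)

  coprime-% : ∀ {a n} .{{_ : NonZero n}} → Coprime a n → Coprime (a % n) n
  coprime-% a⊥n (d∣a%n , d∣n) = a⊥n (∣n∣m%n⇒∣m d∣n d∣a%n , d∣n)

  module _ (k n : ℕ) .{{_ : NonZero n}} where

    private
      IsRoot : ℕ → Set
      IsRoot a = (a ℕ.^ k) % n ≡ 1 % n

      root? = λ a → (a ℕ.^ k) % n ≟ 1 % n

    all-roots⇒annihilates : All IsRoot (units n) → Annihilates k n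
    all-roots⇒annihilates roots a a⊥n = mod-trans (mod-^ k (%≡%⇒mod a (a % n) n (sym (m%n%n≡m%n a n))))
      (mod-trans (mod-reflexive (sym (pos-^ (a % n) k)))
        (%≡%⇒mod _ 1 n (All.lookup roots (∈-filter⁺ (λ b → coprime? b n) (∈-upTo⁺ (m%n<n a n)) (coprime-% a⊥n)))))

    annihilates⇒all-roots : Annihilates k n → All IsRoot (units n)
    annihilates⇒all-roots ann = All.tabulate λ {a} a∈units →
      mod⇒%≡% (a ℕ.^ k) 1 n (mod-trans (mod-reflexive (pos-^ a k))
        (ann a (proj₂ (∈-filter⁻ (λ b → coprime? b n) {xs = upTo n} a∈units))))

    φ≡|kUnits|⇔annihilates : φ n ≡ length (kUnits k n) ⇔ Annihilates k n
    φ≡|kUnits|⇔annihilates = mk⇔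
      (λ φ≡ → all-roots⇒annihilates (subst (All IsRoot) (filter-complete root? (sym φ≡)) (all-filter root? (units n))))
      (λ ann → sym (cong length (filter-all root? (annihilates⇒all-roots ann))))

module Bound where

  open import Data.Bool.Base using (Bool; true; false; T; if_then_else_; _∧_)
  open import Data.Bool.Properties using (T-∧; T-≡)
  open import Data.Bool.ListAction using (any)
  open import Data.List.Base using (List; _∷_; [_]; _++_; map; upTo; foldr)
  open import Data.List.Properties using (upTo-∷ʳ; map-++)
  open import Data.List.Membership.Propositional using (_∈_; find; lose)
  open import Data.List.Membership.Propositional.Properties using (∈-map⁺; ∈-map⁻; ∈-upTo⁺; ∈-upTo⁻; foldr-selective)
  open import Data.List.Relation.Unary.Any using (here; there)
  open import Data.List.Relation.Unary.Any.Properties using (any⁺; any⁻)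
  open import Data.Nat.Base
  open import Data.Nat.Properties
  open import Data.Nat.Divisibility
  open import Data.Nat.Coprimality using (Coprime; coprime-divisor; 1-coprimeTo)
  import Data.Nat.Coprimality as Coprime
  open import Data.Nat.ListAction using (product)
  open import Data.Nat.ListAction.Properties using (product-++; ∈⇒∣product)
  open import Data.Nat.Primality using (Prime; prime?; prime[2]; prime⇒irreducible; ¬prime[1])
  open import Data.Product.Base using (∃₂; _×_; _,_)
  open import Data.Sum.Base using (inj₁; inj₂)
  open import Function.Base using (_∘_)
  open import Function.Bundles using (_⇔_; mk⇔; Equivalence)
  open import Relation.Binary.PropositionalEquality hiding ([_])
  open import Relation.Nullary.Decidable using (yes; no; ⌊_⌋; toWitness; fromWitness; T?)
  open import Relation.Nullary.Negation using (¬_; contradiction)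

  open import Defs
  open Arithmetic

  n<p^n : ∀ {p} → 1 < p → ∀ n → n < p ^ n
  n<p^n {p@(suc _)} 1<p zero    = s≤s z≤n
  n<p^n {p@(suc _)} 1<p (suc n) = begin-strict
    suc n             <⟨ s≤s (n<p^n 1<p n) ⟩
    suc (p ^ n)       ≡⟨ +-comm 1 (p ^ n) ⟩
    p ^ n + 1         ≤⟨ +-monoʳ-≤ (p ^ n) (m^n>0 p n) ⟩
    p ^ n + p ^ n     ≡⟨ cong (p ^ n +_) (sym (+-identityʳ (p ^ n))) ⟩
    2 * p ^ n         ≤⟨ *-monoˡ-≤ (p ^ n) 1<p ⟩
    p * p ^ n         ∎
    where open ≤-Reasoning

  ∈⇒≤foldr-⊔ : ∀ {x xs} → x ∈ xs → x ≤ foldr _⊔_ 0 xs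
  ∈⇒≤foldr-⊔ (here refl)  = m≤m⊔n _ _
  ∈⇒≤foldr-⊔ {xs = y ∷ _} (there x∈xs) = ≤-trans (∈⇒≤foldr-⊔ x∈xs) (m≤n⊔m y _)

  module _ (p M : ℕ) where

    private
      candidate : ℕ → ℕ
      candidate e = if ⌊ p ^ e ∣? M ⌋ then e else 0

      p^candidate∣M : ∀ e → p ^ candidate e ∣ M
      p^candidate∣M e with p ^ e ∣? M
      ... | yes pᵉ∣M = pᵉ∣M
      ... | no  _    = 1∣ M

    p^ν∣M : p ^ ν p M ∣ M
    p^ν∣M with foldr-selective ⊔-sel 0 (map candidate (upTo (suc M)))
    ... | inj₁ ν≡0 = subst (λ e → p ^ e ∣ M) (sym ν≡0) (1∣ M)
    ... | inj₂ ν∈  with ∈-map⁻ candidate {xs = upTo (suc M)} ν∈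
    ...   | e , _ , ν≡ = subst (λ e → p ^ e ∣ M) (sym ν≡) (p^candidate∣M e)

    p^i∣M⇒i≤ν : 1 < p → .{{NonZero M}} → ∀ i → p ^ i ∣ M → i ≤ ν p M
    p^i∣M⇒i≤ν 1<p i pⁱ∣M = subst (_≤ ν p M) candidate≡i
      (∈⇒≤foldr-⊔ (∈-map⁺ candidate {i} (∈-upTo⁺ (s≤s (<⇒≤ (<-≤-trans (n<p^n 1<p i) (∣⇒≤ pⁱ∣M)))))))
      where candidate≡i : candidate i ≡ i
            candidate≡i with p ^ i ∣? M
            ... | yes _   = refl
            ... | no  ¬pⁱ∣M = contradiction pⁱ∣M ¬pⁱ∣M

    p^i∣M⇔i≤ν : 1 < p → .{{NonZero M}} → ∀ i → p ^ i ∣ M ⇔ i ≤ ν p M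
    p^i∣M⇔i≤ν 1<p i = mk⇔ (p^i∣M⇒i≤ν 1<p i) (λ i≤ν → ∣-trans (^-monoʳ-∣ p i≤ν) p^ν∣M)

  SpecialForm : ℕ → ℕ → ℕ → Set
  SpecialForm β M p = ∃₂ λ l d → l < β × d ∣ M × p ≡ 2 ^ suc l * d + 1

  module _ (β M p : ℕ) where

    private
      admissible : ℕ → ℕ → Bool
      admissible l d = ⌊ d ∣? M ⌋ ∧ ⌊ p ≟ 2 ^ suc l * d + 1 ⌋

      admissible-l : ℕ → Bool
      admissible-l l = any (admissible l) (upTo (suc M))

    specialForm⇒ : T (specialForm β M p) → SpecialForm β M p
    specialForm⇒ sf with find (any⁻ admissible-l (upTo β) sf)
    ... | l , l∈ , sfₗ with find (any⁻ (admissible l) (upTo (suc M)) sfₗ)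
    ...   | d , _ , sfₗ,d with Equivalence.to (T-∧ {⌊ d ∣? M ⌋}) sfₗ,d
    ...     | d∣M , p≡ = l , d , ∈-upTo⁻ l∈ , toWitness d∣M , toWitness {a? = p ≟ 2 ^ suc l * d + 1} p≡

    specialForm⇐ : .{{_ : NonZero M}} → SpecialForm β M p → T (specialForm β M p)
    specialForm⇐ (l , d , l<β , d∣M , p≡) =
      any⁺ admissible-l (lose (∈-upTo⁺ l<β) (any⁺ (admissible l) (lose (∈-upTo⁺ (s≤s (∣⇒≤ d∣M)))
        (Equivalence.from (T-∧ {⌊ d ∣? M ⌋}) (fromWitness d∣M , fromWitness {a? = p ≟ 2 ^ suc l * d + 1} p≡)))))

  special⇒p-1∣ : ∀ {β M p} → SpecialForm β M p → p ∸ 1 ∣ 2 ^ β * M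
  special⇒p-1∣ {β} {M} (l , d , l<β , d∣M , refl) =
    subst (_∣ 2 ^ β * M) (sym (m+n∸n≡m (2 ^ suc l * d) 1)) (*-pres-∣ (^-monoʳ-∣ 2 l<β) d∣M)

  p-1∣⇒special : ∀ {β M p} → Prime p → ¬ 2 ∣ p → ¬ 2 ∣ M → p ∸ 1 ∣ 2 ^ β * M → SpecialForm β M p
  p-1∣⇒special {β} {M} {p} pr 2∤p 2∤M p-1∣k with odd⇒≡1+2* p 2∤p
  ... | zero    , refl = contradiction pr ¬prime[1]
  ... | h@(suc _) , refl with split-power 2 (s≤s (s≤s z≤n)) (2 * h)
  ...   | zero  , r , 2h≡r , 2∤r = contradiction (divides h (trans (sym (trans 2h≡r (+-identityʳ r))) (*-comm 2 h))) 2∤r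
  ...   | suc l , r , 2h≡2ˡ⁺¹r , 2∤r = l , r , l<β , r∣M , trans (+-comm 1 (2 * h)) (cong (_+ 1) 2h≡2ˡ⁺¹r)
    where
      2ˡ⁺¹r∣k : 2 ^ suc l * r ∣ 2 ^ β * M
      2ˡ⁺¹r∣k = subst (_∣ 2 ^ β * M) 2h≡2ˡ⁺¹r p-1∣k
      r∣M : r ∣ M
      r∣M = coprime-divisor (Coprime.sym (^-coprime β (prime∤⇒coprime prime[2] 2∤r))) (∣-trans (n∣m*n (2 ^ suc l)) 2ˡ⁺¹r∣k)
      l<β : l < β
      l<β = ^-∣^⇒≤ 2 (s≤s (s≤s z≤n)) (coprime-divisor (^-coprime (suc l) (prime∤⇒coprime prime[2] 2∤M))
              (subst (2 ^ suc l ∣_) (*-comm (2 ^ β) M) (∣-trans (m∣m*n r) 2ˡ⁺¹r∣k)))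

  factor-special : ∀ {β M p} .{{_ : NonZero M}} → Prime p → T (specialForm β M p) → factor β M p ≡ p ^ (ν p M + 1)
  factor-special {β} {M} {p} pr sf with prime? p
  ... | no ¬pr = contradiction pr ¬pr
  ... | yes _ rewrite Equivalence.to T-≡ sf with p ∣? M
  ...   | yes _   = refl
  ...   | no  p∤M = trans (sym (*-identityʳ p)) (cong (λ e → p ^ (e + 1)) (sym ν≡0))
    where ν≡0 : ν p M ≡ 0
          ν≡0 = n≤0⇒n≡0 (≮⇒≥ (λ 0<ν → p∤M (subst (_∣ M) (*-identityʳ p)
                  (Equivalence.from (p^i∣M⇔i≤ν p M (prime>1 pr) 1) 0<ν))))

  factor-nonspecial : ∀ {β M p} → ¬ T (specialForm β M p) → factor β M p ≡ 1
  factor-nonspecial {β} {M} {p} ¬sf with prime? p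
  ... | no  _ = refl
  ... | yes _ with specialForm β M p
  ...   | false = refl
  ...   | true  = contradiction _ ¬sf

  distinct-primes-coprime : ∀ {p q} → Prime p → Prime q → q ≢ p → Coprime p q
  distinct-primes-coprime {p} {q} pr qr q≢p = prime∤⇒coprime pr p∤q
    where p∤q : ¬ p ∣ q
          p∤q p∣q with prime⇒irreducible qr p∣q
          ... | inj₁ refl = ¬prime[1] pr
          ... | inj₂ refl = q≢p refl

  factor-coprime : ∀ {β M p} q → Prime p → q ≢ p → Coprime p (factor β M q)
  factor-coprime {β} {M} {p} q pr q≢p with prime? q
  ... | no  _  = Coprime.sym (1-coprimeTo p)
  ... | yes qr with specialForm β M q
  ...   | false = Coprime.sym (1-coprimeTo p)
  ...   | true with q ∣? M
  ...     | yes _ = coprime-^ (distinct-primes-coprime pr qr q≢p) (ν q M + 1)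
  ...     | no  _ = distinct-primes-coprime pr qr q≢p

  factor[2]≡1 : ∀ β M → factor β M 2 ≡ 1
  factor[2]≡1 β M = factor-nonspecial {β} {M} (not-special ∘ specialForm⇒ β M 2)
    where not-special : ¬ SpecialForm β M 2
          not-special (l , d , _ , _ , 2≡) with ∣1⇒≡1 (∣m+n∣m⇒∣n (subst (2 ∣_) 2≡ ∣-refl) (∣m⇒∣m*n d (m∣m*n (2 ^ l))))
          ... | ()

  prodUpTo : (ℕ → ℕ) → ℕ → ℕ
  prodUpTo f N = product (map f (upTo N))

  prodUpTo-suc : ∀ f N → prodUpTo f (suc N) ≡ prodUpTo f N * f N
  prodUpTo-suc f N = begin
    product (map f (upTo (suc N)))       ≡⟨ cong (product ∘ map f) (upTo-∷ʳ N) ⟨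
    product (map f (upTo N ++ [ N ]))    ≡⟨ cong product (map-++ f (upTo N) [ N ]) ⟩
    product (map f (upTo N) ++ [ f N ])  ≡⟨ product-++ (map f (upTo N)) [ f N ] ⟩
    prodUpTo f N * (f N * 1)             ≡⟨ cong (prodUpTo f N *_) (*-identityʳ (f N)) ⟩
    prodUpTo f N * f N                   ∎
    where open ≡-Reasoning

  coprime-prodUpTo : ∀ {d} f N → (∀ q → q < N → Coprime d (f q)) → Coprime d (prodUpTo f N)
  coprime-prodUpTo {d} f zero    _      = Coprime.sym (1-coprimeTo d)
  coprime-prodUpTo {d} f (suc N) d⊥f[q] = subst (Coprime d) (sym (prodUpTo-suc f N))
    (coprime-* (coprime-prodUpTo f N (λ q q<N → d⊥f[q] q (m<n⇒m<1+n q<N))) (d⊥f[q] N (n<1+n N)))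

  ∣prodUpTo⇒∣ : ∀ {d} f p N → (∀ q → q ≢ p → Coprime d (f q)) → d ∣ prodUpTo f N → d ∣ f p
  ∣prodUpTo⇒∣ f p zero    _      d∣1 = subst (_∣ f p) (sym (∣1⇒≡1 d∣1)) (1∣ f p)
  ∣prodUpTo⇒∣ {d} f p (suc N) d⊥f[q] d∣∏ with N ≟ p | subst (d ∣_) (prodUpTo-suc f N) d∣∏
  ... | yes refl | d∣∏*f[p] = coprime-divisor (coprime-prodUpTo f N (λ q q<N → d⊥f[q] q (<⇒≢ q<N))) d∣∏*f[p]
  ... | no  N≢p  | d∣∏*f[N] =
    ∣prodUpTo⇒∣ f p N d⊥f[q] (coprime-divisor (d⊥f[q] N N≢p) (subst (d ∣_) (*-comm (prodUpTo f N) (f N)) d∣∏*f[N]))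

  ∣prodUpTo : ∀ f {q N} → q < N → f q ∣ prodUpTo f N
  ∣prodUpTo f q<N = ∈⇒∣product (∈-map⁺ f (∈-upTo⁺ q<N))

  2^e∣bound⇔ : ∀ β M e → 2 ^ e ∣ bound β M ⇔ e ≤ 2 + β
  2^e∣bound⇔ β M e = mk⇔ to from
    where
      ∏ = prodUpTo (factor β M) (2 ^ β * M + 2)
      2⊥factor : ∀ q → Coprime 2 (factor β M q)
      2⊥factor q with q ≟ 2
      ... | yes refl = subst (Coprime 2) (sym (factor[2]≡1 β M)) (Coprime.sym (1-coprimeTo 2))
      ... | no  q≢2  = factor-coprime {β} {M} q prime[2] q≢2
      to : 2 ^ e ∣ bound β M → e ≤ 2 + β
      to 2ᵉ∣B = subst (e ≤_) (+-comm β 2) (^-∣^⇒≤ 2 (s≤s (s≤s z≤n))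
        (coprime-divisor (^-coprime e (coprime-prodUpTo (factor β M) (2 ^ β * M + 2) (λ q _ → 2⊥factor q)))
                         (subst (2 ^ e ∣_) (*-comm (2 ^ (β + 2)) ∏) 2ᵉ∣B)))
      from : e ≤ 2 + β → 2 ^ e ∣ bound β M
      from e≤2+β = ∣-trans (^-monoʳ-∣ 2 (subst (e ≤_) (+-comm 2 β) e≤2+β)) (m∣m*n ∏)

  p-1∣k⇒p<k+2 : ∀ {p k} .{{_ : NonZero k}} → p ∸ 1 ∣ k → p < k + 2
  p-1∣k⇒p<k+2 {zero}  {k} _     = subst (0 <_) (+-comm 2 k) z<s
  p-1∣k⇒p<k+2 {suc p} {k} p∣k = subst (suc p <_) (+-comm 2 k) (s≤s (s≤s (∣⇒≤ p∣k)))

  odd-prime^∣bound⇔ : ∀ β M {p} i → Prime p → ¬ 2 ∣ p → ¬ 2 ∣ M →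
                      p ^ suc i ∣ bound β M ⇔ (p ∸ 1 ∣ 2 ^ β * M × p ^ i ∣ M)
  odd-prime^∣bound⇔ β M {p} i pr 2∤p 2∤M = mk⇔ to from
    where
      instance
        _ : NonZero M
        _ = ¬2∣⇒nonZero 2∤M
        _ : NonZero (2 ^ β * M)
        _ = m*n≢0 (2 ^ β) M {{m^n≢0 2 β}}
      ∏ = prodUpTo (factor β M) (2 ^ β * M + 2)
      p^i∣M⇔ = p^i∣M⇔i≤ν p M (prime>1 pr) i
      suc≤ν+1⇔ : suc i ≤ ν p M + 1 ⇔ i ≤ ν p M
      suc≤ν+1⇔ = mk⇔ (λ le → s≤s⁻¹ (subst (suc i ≤_) (+-comm (ν p M) 1) le)) (λ le → subst (suc i ≤_) (+-comm 1 (ν p M)) (s≤s le))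
      pⁱ⁺¹∣factor : p ^ suc i ∣ bound β M → p ^ suc i ∣ factor β M p
      pⁱ⁺¹∣factor pⁱ⁺¹∣B = ∣prodUpTo⇒∣ (factor β M) p (2 ^ β * M + 2) (λ q q≢p → ^-coprime (suc i) (factor-coprime {β} {M} q pr q≢p))
        (coprime-divisor (^-coprime (suc i) (coprime-^ (distinct-primes-coprime pr prime[2] 2≢p) (β + 2))) pⁱ⁺¹∣B)
        where 2≢p : 2 ≢ p
              2≢p 2≡p = 2∤p (subst (2 ∣_) 2≡p ∣-refl)
      to : p ^ suc i ∣ bound β M → p ∸ 1 ∣ 2 ^ β * M × p ^ i ∣ M
      to pⁱ⁺¹∣B with T? (specialForm β M p)
      ... | yes sf = special⇒p-1∣ (specialForm⇒ β M p sf) ,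
        Equivalence.from p^i∣M⇔ (Equivalence.to suc≤ν+1⇔
          (^-∣^⇒≤ p (prime>1 pr) (subst (p ^ suc i ∣_) (factor-special {β} {M} pr sf) (pⁱ⁺¹∣factor pⁱ⁺¹∣B))))
      ... | no ¬sf with ^-∣^⇒≤ p (prime>1 pr) {suc i} {0} (subst (p ^ suc i ∣_) (factor-nonspecial {β} {M} ¬sf) (pⁱ⁺¹∣factor pⁱ⁺¹∣B))
      ...   | ()
      from : p ∸ 1 ∣ 2 ^ β * M × p ^ i ∣ M → p ^ suc i ∣ bound β M
      from (p-1∣k , pⁱ∣M) =
        ∣-trans (subst (p ^ suc i ∣_) (sym (factor-special {β} {M} pr sf)) (^-monoʳ-∣ p {suc i} (Equivalence.from suc≤ν+1⇔ (Equivalence.to p^i∣M⇔ pⁱ∣M))))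
                (∣-trans (∣prodUpTo (factor β M) {p} (p-1∣k⇒p<k+2 p-1∣k)) (n∣m*n (2 ^ (β + 2))))
        where sf = specialForm⇐ β M p (p-1∣⇒special pr 2∤p 2∤M p-1∣k)

open import Data.Nat.Base
open import Data.Nat.Properties
open import Data.Nat.Divisibility using (_∣_; divides; ∣-trans; m∣m*n; n∣m*n; _∣0; 1∣_)
open import Data.Nat.Coprimality using (Coprime; coprime-divisor)
import Data.Nat.Coprimality as Coprime
open import Data.Nat.Induction using (<-rec)
open import Data.Nat.ListAction using (product)
open import Data.Nat.Primality using (Prime; prime[2]; prime⇒nonZero; prime⇒irreducible)
open import Data.Nat.Primality.Factorisation using (factorise)
open import Data.List.Base using (length; []; _∷_)
open import Data.List.Relation.Unary.All using (_∷_)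
open import Data.Sum.Base using (inj₁; inj₂)
open import Data.Product.Base using (∃-syntax; _×_; _,_)
open import Data.Product.Function.NonDependent.Propositional using (_×-⇔_)
open import Function.Base using (_∘_)
open import Function.Bundles using (_⇔_; mk⇔; Equivalence)
open import Function.Properties.Equivalence using (⇔-setoid) renaming (refl to ⇔-refl; trans to ⇔-trans)
open import Level using (0ℓ)
import Relation.Binary.Reasoning.Setoid as SetoidReasoning
open import Relation.Binary.PropositionalEquality
open import Relation.Nullary.Decidable using (yes; no)
open import Relation.Nullary.Negation using (¬_; contradiction)

open import Defs
open Arithmetic
open Annihilator
open UnitCount
open Bound

prime-factor : ∀ n .{{_ : NonZero n}} → 1 < n → ∃[ p ] Prime p × p ∣ n
prime-factor n 1<n with factorise n
... | record { factors = [] ; isFactorisation = n≡1 } = contradiction n≡1 (>⇒≢ 1<n)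
... | record { factors = p ∷ ps ; isFactorisation = n≡p*∏ ; factorsPrime = pr ∷ _ } =
  p , pr , divides (product ps) (trans n≡p*∏ (*-comm p (product ps)))

Multiplicative : (ℕ → Set) → Set
Multiplicative P = ∀ {m n} → Coprime m n → P (m * n) ⇔ (P m × P n)

multiplicative-equivalence : ∀ {P Q} → Multiplicative P → Multiplicative Q →
                             (∀ {p} e → Prime p → P (p ^ e) ⇔ Q (p ^ e)) →
                             ∀ n .{{_ : NonZero n}} → P n ⇔ Q n
multiplicative-equivalence {P} {Q} mul-P mul-Q local = <-rec (λ n → .{{NonZero n}} → P n ⇔ Q n) step
  where
    step : ∀ n → (∀ {r} → r < n → .{{NonZero r}} → P r ⇔ Q r) → .{{NonZero n}} → P n ⇔ Q n
    step 1                  _   = local 0 prime[2]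
    step n@(suc (suc _)) rec with prime-factor n (s≤s (s≤s z≤n))
    ... | p , pr , p∣n with split-power p (prime>1 pr) n
    ...   | zero  , r , n≡r , p∤r = contradiction (subst (p ∣_) (trans n≡r (+-identityʳ r)) p∣n) p∤r
    ...   | suc a , r , n≡pᵃ⁺¹r , p∤r = begin
      P n                          ≡⟨ cong P n≡pᵃ⁺¹r ⟩
      P (p ^ suc a * r)            ≈⟨ mul-P pᵃ⁺¹⊥r ⟩
      (P (p ^ suc a) × P r)        ≈⟨ local (suc a) pr ×-⇔ rec r<n ⟩
      (Q (p ^ suc a) × Q r)        ≈⟨ mul-Q pᵃ⁺¹⊥r ⟨
      Q (p ^ suc a * r)            ≡⟨ cong Q n≡pᵃ⁺¹r ⟨
      Q n                          ∎
      where
        open SetoidReasoning (⇔-setoid 0ℓ)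
        instance
          _ : NonZero p
          _ = prime⇒nonZero pr
          _ : NonZero r
          _ = ≢-nonZero λ { refl → p∤r (p ∣0) }
        pᵃ⁺¹⊥r : Coprime (p ^ suc a) r
        pᵃ⁺¹⊥r = ^-coprime (suc a) (prime∤⇒coprime pr p∤r)
        r<n : r < n
        r<n = subst (r <_) (trans (*-comm r (p ^ suc a)) (sym n≡pᵃ⁺¹r))
                (m<m*n r (p ^ suc a) (<-≤-trans (prime>1 pr) (m≤m*n p (p ^ a) {{m^n≢0 p a}})))

annihilates-multiplicative : ∀ k → Multiplicative (Annihilates k)
annihilates-multiplicative k {m} {n} m⊥n = mk⇔
  (λ ann → annihilates-*⁻ {k} m⊥n ann , annihilates-*⁻ {k} (Coprime.sym m⊥n) (subst (Annihilates k) (*-comm m n) ann))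
  (λ (ann-m , ann-n) → annihilates-* {k} m⊥n ann-m ann-n)

∣-multiplicative : ∀ B → Multiplicative (_∣ B)
∣-multiplicative B {m} {n} m⊥n = mk⇔
  (λ mn∣B → ∣-trans (m∣m*n n) mn∣B , ∣-trans (n∣m*n m) mn∣B)
  (λ (m∣B , n∣B) → coprime⇒*∣ m⊥n m∣B n∣B)

annihilates⇔∣bound-prime-power : ∀ β M → 0 < β → ¬ 2 ∣ M → ∀ {p} e → Prime p →
                                 Annihilates (2 ^ β * M) (p ^ e) ⇔ p ^ e ∣ bound β M
annihilates⇔∣bound-prime-power β M 0<β 2∤M {p} e pr with p ≟ 2
... | yes refl = mk⇔ (Equivalence.from (2^e∣bound⇔ β M e) ∘ annihilates-2^⇒ β M e 2∤M)
                     (annihilates-2^⇐ β M e 0<β ∘ Equivalence.to (2^e∣bound⇔ β M e))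
... | no p≢2 with e
...   | zero  = mk⇔ (λ _ → 1∣ bound β M) (λ _ → annihilates-1 (2 ^ β * M))
...   | suc i = begin
  Annihilates (2 ^ β * M) (p ^ suc i)       ≈⟨ mk⇔ (annihilates-odd-prime^⇒ _ i pr 2∤p) (λ (p-1∣k , pⁱ∣k) → annihilates-prime^⇐ _ i pr p-1∣k pⁱ∣k) ⟩
  (p ∸ 1 ∣ 2 ^ β * M × p ^ i ∣ 2 ^ β * M)   ≈⟨ ⇔-refl ×-⇔ mk⇔ (coprime-divisor pⁱ⊥2ᵝ) (λ pⁱ∣M → ∣-trans pⁱ∣M (n∣m*n (2 ^ β))) ⟩
  (p ∸ 1 ∣ 2 ^ β * M × p ^ i ∣ M)           ≈⟨ odd-prime^∣bound⇔ β M i pr 2∤p 2∤M ⟨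
  p ^ suc i ∣ bound β M                     ∎
  where
    open SetoidReasoning (⇔-setoid 0ℓ)
    2∤p : ¬ 2 ∣ p
    2∤p 2∣p with prime⇒irreducible pr 2∣p
    ... | inj₁ ()
    ... | inj₂ 2≡p = p≢2 (sym 2≡p)
    pⁱ⊥2ᵝ : Coprime (p ^ i) (2 ^ β)
    pⁱ⊥2ᵝ = ^-coprime i (coprime-^ (distinct-primes-coprime pr prime[2] (p≢2 ∘ sym)) β)

theorem12 : (β M n : ℕ) → 0 < β → ¬ (2 ∣ M) → .{{_ : NonZero n}} →
    ((φ n ≡ length (kUnits (2 ^ β * M) n)) → n ∣ bound β M) ×
    (n ∣ bound β M → φ n ≡ length (kUnits (2 ^ β * M) n))
theorem12 β M n 0<β 2∤M = Equivalence.to φ≡|kUnits|⇔∣bound , Equivalence.from φ≡|kUnits|⇔∣bound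
  where
    φ≡|kUnits|⇔∣bound = ⇔-trans (φ≡|kUnits|⇔annihilates (2 ^ β * M) n)
      (multiplicative-equivalence (annihilates-multiplicative (2 ^ β * M)) (∣-multiplicative (bound β M))
                                  (annihilates⇔∣bound-prime-power β M 0<β 2∤M) n)
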